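{- For every triangle-free graph $G$, $\mathrm{gap}(G)\ge \lceil |V(G)|/2\rceil-\alpha(G)$, with equality if $G$ is connected, triangle-free and gap-critical. Furthermore, if there exists a triangle-free gap-extremal graph of order $n$ with $k$ connected components of orders $n_1,\dots,n_k$, then $$\mathrm{gap}_2(n)=\sum_{i=1}^{k}\left(\lceil n_i/2\rceil-\alpha(n_i)\right).$$
   Context: All graphs are finite, simple and undirected. $\alpha(G)$ denotes the maximum size of a stable set, $\theta(G)$ the minimum number of cliques partitioning $V(G)$, and $\mathrm{gap}(G)=\theta(G)-\alpha(G)$. A graph $G$ is gap-critical if $\mathrm{gap}(H)<\mathrm{gap}(G)$ for every proper induced subgraph $H$ of $G$. $s_2(t)$ is the smallest number of vertices of a triangle-free graph with gap $t$; a triangle-free gap-extremal graph is a triangle-free graph $G$ with $|V(G)|=s_2(\mathrm{gap}(G))$. $\mathrm{gap}_2(n)$ is the maximum gap of a triangle-free graph on $n$ vertices, and $\alpha(n)$ is the minimum of $\alpha(H)$ over triangle-free graphs $H$ on $n$ vertices. -}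

module Defs where

open import Data.Nat using (ℕ; zero; suc; _≤_; _<_; ⌈_/2⌉)
open import Data.Integer as ℤ using (ℤ; +_; _-_)
open import Data.Bool using (Bool; true; false; if_then_else_)
open import Data.Fin using (Fin; zero; suc; _≟_)
open import Data.Fin.Subset using (Subset; _∈_; ∣_∣)
open import Data.Product using (Σ; Σ-syntax; ∃; _×_; _,_)
open import Relation.Binary.PropositionalEquality using (_≡_; _≢_)
open import Relation.Binary.Construct.Closure.ReflexiveTransitive using (Star)
open import Relation.Nullary using (does)
open import Data.Empty using (⊥)
open import Function.Definitions using (Injective)

record Graph (n : ℕ) : Set where
  field
    adj  : Fin n → Fin n → Bool
    sym  : ∀ i j → adj i j ≡ adj j i
    irr  : ∀ i → adj i i ≡ false
open Graph public

Edge : ∀ {n} → Graph n → Fin n → Fin n → Set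
Edge G i j = adj G i j ≡ true

TriangleFree : ∀ {n} → Graph n → Set
TriangleFree G = ∀ i j k → Edge G i j → Edge G j k → Edge G i k → ⊥

Connected : ∀ {n} → Graph n → Set
Connected G = ∀ i j → Star (Edge G) i j

-- induced subgraph on the image of f (f injective gives a genuine induced subgraph)
induce : ∀ {m n} → Graph n → (Fin m → Fin n) → Graph m
induce G f = record
  { adj = λ i j → adj G (f i) (f j)
  ; sym = λ i j → sym G (f i) (f j)
  ; irr = λ i → irr G (f i) }

Stable : ∀ {n} → Graph n → Subset n → Set
Stable G S = ∀ i j → i ∈ S → j ∈ S → adj G i j ≡ false

IsAlpha : ∀ {n} → Graph n → ℕ → Set
IsAlpha {n} G a =
  (Σ[ S ∈ Subset n ] (Stable G S × ∣ S ∣ ≡ a)) × (∀ (S : Subset n) → Stable G S → ∣ S ∣ ≤ a)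

-- partition of V(G) into (at most) k cliques: class map c, distinct vertices in a class adjacent
CliquePartition : ∀ {n} → Graph n → ℕ → Set
CliquePartition {n} G k =
  Σ[ c ∈ (Fin n → Fin k) ] (∀ i j → c i ≡ c j → i ≢ j → Edge G i j)

IsTheta : ∀ {n} → Graph n → ℕ → Set
IsTheta G t = CliquePartition G t × (∀ k → CliquePartition G k → t ≤ k)

HasGap : ∀ {n} → Graph n → ℤ → Set
HasGap G g = Σ[ a ∈ ℕ ] Σ[ t ∈ ℕ ] (IsAlpha G a × IsTheta G t × g ≡ + t - + a)

GapCritical : ∀ {n} → Graph n → Set
GapCritical {n} G =
  ∀ m (f : Fin m → Fin n) → Injective _≡_ _≡_ f → m < n →
  ∀ h g → HasGap (induce G f) h → HasGap G g → h ℤ.< g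

IsS2 : ℤ → ℕ → Set
IsS2 t s =
  (Σ[ H ∈ Graph s ] (TriangleFree H × HasGap H t)) ×
  (∀ m (H : Graph m) → TriangleFree H → HasGap H t → s ≤ m)

GapExtremalTF : ∀ {n} → Graph n → Set
GapExtremalTF {n} G = TriangleFree G × (Σ[ g ∈ ℤ ] (HasGap G g × IsS2 g n))

IsGap2 : ℕ → ℤ → Set
IsGap2 n g =
  (Σ[ H ∈ Graph n ] (TriangleFree H × HasGap H g)) ×
  (∀ (H : Graph n) → TriangleFree H → ∀ h → HasGap H h → h ℤ.≤ g)

IsAlphaN : ℕ → ℕ → Set
IsAlphaN n a =
  (Σ[ H ∈ Graph n ] (TriangleFree H × IsAlpha H a)) ×
  (∀ (H : Graph n) → TriangleFree H → ∀ b → IsAlpha H b → a ≤ b)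

count : ∀ {n} → (Fin n → Bool) → ℕ
count {zero} p = 0
count {suc n} p = (if p zero then 1 else 0) Data.Nat.+ count (λ i → p (suc i))

IsComponentLabelling : ∀ {n} → Graph n → (k : ℕ) → (Fin n → Fin k) → Set
IsComponentLabelling {n} G k comp =
  (∀ (c : Fin k) → ∃ λ i → comp i ≡ c) ×
  (∀ i j → (comp i ≡ comp j → Star (Edge G) i j) × (Star (Edge G) i j → comp i ≡ comp j))

compOrder : ∀ {n k} → (Fin n → Fin k) → Fin k → ℕ
compOrder comp c = count (λ i → does (comp i ≟ c))

sumℤ : ∀ {k} → (Fin k → ℤ) → ℤ
sumℤ {zero} f = + 0
sumℤ {suc k} f = f zero ℤ.+ sumℤ (λ i → f (suc i))

module Submission where

-- In a triangle-free graph every clique has at most two vertices, so a clique partition is a matching plus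
-- singletons: θ = n - ν ≥ ⌈n/2⌉. If G is gap-critical, deleting a vertex w must lower θ (α cannot grow), which
-- produces a maximum matching missing w; for connected G, Gallai's lemma (exchange two maximum matchings along
-- an alternating path) then shows that a maximum matching misses at most one vertex, i.e. θ = ⌈n/2⌉.
-- For a gap-extremal graph, α, θ and the gap add up over the components. Deleting a vertex lowers the gap by at
-- most one, so a graph with a smaller induced subgraph of the same gap is not extremal; hence every component is
-- gap-critical and contributes ⌈n_i/2⌉ - α(G_i). Replacing a component by a triangle-free graph of the same order
-- with α = α(n_i) shows α(G_i) = α(n_i), and the same descent argument shows gap(G) = gap₂(n).

module Counting where

  open import Defs using (count)
  import Data.Nat.Properties as ℕ
  open import Algebra.Properties.CommutativeMonoid.Sum ℕ.+-0-commutativeMonoid using (sum; sum-cong-≗; ∑-distrib-+)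
  open import Data.Bool using (Bool; true; false; if_then_else_; _∧_; _∨_; not)
  open import Data.Empty using (⊥-elim)
  open import Data.Fin using (Fin; zero; suc; _≟_; splitAt; join; fromℕ<; toℕ)
  open import Data.Fin.Properties using (suc-injective; injective⇒≤; join-splitAt; toℕ-fromℕ<)
  open import Data.Nat using (ℕ; zero; suc; _+_; _≤_; _<_; z≤n; z<s)
  open import Data.Nat.Properties using (≤-refl; +-mono-≤; +-identityʳ; <-trans)
  open import Data.Product using (Σ; _×_; _,_)
  open import Data.Sum using (_⊎_; inj₁; inj₂)
  open import Relation.Binary.PropositionalEquality
  open import Relation.Nullary using (Dec; does; yes; no)
  open import Axiom.UniquenessOfIdentityProofs using (UIP; module Decidable⇒UIP)
  import Data.Bool.Properties as Bool

  dec-true⁻¹ : ∀ {A : Set} (a? : Dec A) → does a? ≡ true → A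
  dec-true⁻¹ (yes a) _ = a
  dec-true⁻¹ (no _) ()

  ≡-irrelevantᵇ : UIP Bool
  ≡-irrelevantᵇ = Decidable⇒UIP.≡-irrelevant Bool._≟_

  bit : Bool → ℕ
  bit b = if b then 1 else 0

  count≡sum : ∀ {n} (p : Fin n → Bool) → count p ≡ sum (λ x → bit (p x))
  count≡sum {zero} p = refl
  count≡sum {suc n} p = cong (bit (p zero) +_) (count≡sum (λ i → p (suc i)))

  sum-mono-≤ : ∀ {n} {f g : Fin n → ℕ} → (∀ x → f x ≤ g x) → sum f ≤ sum g
  sum-mono-≤ {zero} f≤g = z≤n
  sum-mono-≤ {suc n} f≤g = +-mono-≤ (f≤g zero) (sum-mono-≤ (λ i → f≤g (suc i)))

  count+count≡sum : ∀ {n} (p q : Fin n → Bool) → count p + count q ≡ sum (λ x → bit (p x) + bit (q x))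
  count+count≡sum p q = begin
    count p + count q                              ≡⟨ cong₂ _+_ (count≡sum p) (count≡sum q) ⟩
    sum (λ x → bit (p x)) + sum (λ x → bit (q x))  ≡⟨ ∑-distrib-+ (λ x → bit (p x)) (λ x → bit (q x)) ⟨
    sum (λ x → bit (p x) + bit (q x))              ∎
    where open ≡-Reasoning

  count-cong : ∀ {n} {p q : Fin n → Bool} → (∀ x → p x ≡ q x) → count p ≡ count q
  count-cong {p = p} {q} p≗q = begin
    count p                ≡⟨ count≡sum p ⟩
    sum (λ x → bit (p x))  ≡⟨ sum-cong-≗ (λ x → cong bit (p≗q x)) ⟩
    sum (λ x → bit (q x))  ≡⟨ count≡sum q ⟨
    count q                ∎
    where open ≡-Reasoning

  count+count≤count : ∀ {n} (p q r : Fin n → Bool) →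
    (∀ x → bit (p x) + bit (q x) ≤ bit (r x)) → count p + count q ≤ count r
  count+count≤count p q r pointwise =
    subst₂ _≤_ (sym (count+count≡sum p q)) (sym (count≡sum r)) (sum-mono-≤ pointwise)

  count+count+count≤count : ∀ {n} (p q r s : Fin n → Bool) →
    (∀ x → bit (p x) + bit (q x) + bit (r x) ≤ bit (s x)) → count p + count q + count r ≤ count s
  count+count+count≤count p q r s pointwise =
    subst₂ _≤_ (sym lhs) (sym (count≡sum s)) (sum-mono-≤ pointwise)
    where
    lhs : count p + count q + count r ≡ sum (λ x → bit (p x) + bit (q x) + bit (r x))
    lhs = trans (cong₂ _+_ (count+count≡sum p q) (count≡sum r))
                (sym (∑-distrib-+ (λ x → bit (p x) + bit (q x)) (λ x → bit (r x))))

  count+count≡count+count : ∀ {n} (p q r s : Fin n → Bool) →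
    (∀ x → bit (p x) + bit (q x) ≡ bit (r x) + bit (s x)) → count p + count q ≡ count r + count s
  count+count≡count+count p q r s pointwise =
    trans (count+count≡sum p q) (trans (sum-cong-≗ pointwise) (sym (count+count≡sum r s)))

  count-const-true : ∀ {n} → count {n} (λ _ → true) ≡ n
  count-const-true {zero} = refl
  count-const-true {suc n} = cong suc (count-const-true {n})

  count-const-false : ∀ {n} → count {n} (λ _ → false) ≡ 0
  count-const-false {zero} = refl
  count-const-false {suc n} = count-const-false {n}

  count-≡ : ∀ {n} (u : Fin n) → count (λ x → does (x ≟ u)) ≡ 1
  count-≡ {suc n} zero = cong suc (count-const-false {n})
  count-≡ {suc n} (suc u) = trans (count-cong suc≟suc) (count-≡ u)
    where
    suc≟suc : ∀ x → does (suc x ≟ suc u) ≡ does (x ≟ u)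
    suc≟suc x with x ≟ u
    ... | yes _ = refl
    ... | no _ = refl

  count-split : ∀ {n} (p q : Fin n → Bool) → count p ≡ count (λ x → p x ∧ q x) + count (λ x → p x ∧ not (q x))
  count-split {n} p q = sym (trans (count+count≡count+count (λ x → p x ∧ q x) (λ x → p x ∧ not (q x)) p (λ (_ : Fin n) → false) (λ x → split (p x) (q x)))
                               (trans (cong (count p +_) (count-const-false {n})) (+-identityʳ (count p))))
    where
    split : ∀ a b → bit (a ∧ b) + bit (a ∧ not b) ≡ bit a + 0
    split false b = refl
    split true false = refl
    split true true = refl

  count-∨ : ∀ {n} (p q : Fin n → Bool) → (∀ x → p x ∧ q x ≡ false) →
    count (λ x → p x ∨ q x) ≡ count p + count q
  count-∨ {n} p q disjoint = begin
    count (λ x → p x ∨ q x)      ≡⟨ +-identityʳ _ ⟨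
    count (λ x → p x ∨ q x) + 0  ≡⟨ cong (count (λ x → p x ∨ q x) +_) (count-const-false {n}) ⟨
    count (λ x → p x ∨ q x) + count (λ (_ : Fin n) → false)
      ≡⟨ count+count≡count+count (λ x → p x ∨ q x) (λ _ → false) p q (λ x → union (p x) (q x) (disjoint x)) ⟩
    count p + count q            ∎
    where
    open ≡-Reasoning
    union : ∀ a b → a ∧ b ≡ false → bit (a ∨ b) + 0 ≡ bit a + bit b
    union false false _ = refl
    union false true _ = refl
    union true false _ = refl

  count-mono : ∀ {n} {p q : Fin n → Bool} → (∀ x → p x ≡ true → q x ≡ true) → count p ≤ count q
  count-mono {p = p} {q} p⊆q =
    subst₂ _≤_ (sym (count≡sum p)) (sym (count≡sum q)) (sum-mono-≤ (λ x → pointwise (p x) (q x) (p⊆q x)))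
    where
    pointwise : ∀ a b → (a ≡ true → b ≡ true) → bit a ≤ bit b
    pointwise false b _ = z≤n
    pointwise true b a⇒b rewrite a⇒b refl = ≤-refl

  enum : ∀ {n} (p : Fin n → Bool) → Fin (count p) → Fin n
  enum {suc n} p i with p zero
  enum {suc n} p zero    | true = zero
  enum {suc n} p (suc i) | true = suc (enum (λ j → p (suc j)) i)
  enum {suc n} p i       | false = suc (enum (λ j → p (suc j)) i)

  enum-true : ∀ {n} (p : Fin n → Bool) (i : Fin (count p)) → p (enum p i) ≡ true
  enum-true {suc n} p i with p zero in eq
  enum-true {suc n} p zero    | true = eq
  enum-true {suc n} p (suc i) | true = enum-true (λ j → p (suc j)) i
  enum-true {suc n} p i       | false = enum-true (λ j → p (suc j)) i

  enum-injective : ∀ {n} (p : Fin n → Bool) {i j : Fin (count p)} → enum p i ≡ enum p j → i ≡ j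
  enum-injective {suc n} p {i} {j} e with p zero
  enum-injective {suc n} p {zero} {zero} e | true = refl
  enum-injective {suc n} p {suc i} {suc j} e | true = cong suc (enum-injective _ (suc-injective e))
  enum-injective {suc n} p {i} {j} e | false = enum-injective _ (suc-injective e)

  rank : ∀ {n} (p : Fin n → Bool) (x : Fin n) → p x ≡ true → Fin (count p)
  rank {suc n} p zero px with p zero
  rank {suc n} p zero px | true = zero
  rank {suc n} p zero () | false
  rank {suc n} p (suc x) px with p zero
  ... | true = suc (rank (λ j → p (suc j)) x px)
  ... | false = rank (λ j → p (suc j)) x px

  enum-rank : ∀ {n} (p : Fin n → Bool) (x : Fin n) (px : p x ≡ true) → enum p (rank p x px) ≡ x
  enum-rank {suc n} p zero px with p zero
  enum-rank {suc n} p zero px | true = refl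
  enum-rank {suc n} p zero () | false
  enum-rank {suc n} p (suc x) px with p zero
  ... | true = cong suc (enum-rank (λ j → p (suc j)) x px)
  ... | false = cong suc (enum-rank (λ j → p (suc j)) x px)

  rank-enum : ∀ {n} (p : Fin n → Bool) (i : Fin (count p)) (pe : p (enum p i) ≡ true) → rank p (enum p i) pe ≡ i
  rank-enum p i pe = enum-injective p (enum-rank p (enum p i) pe)

  rank-injective : ∀ {n} (p : Fin n → Bool) {x y : Fin n} px py → rank p x px ≡ rank p y py → x ≡ y
  rank-injective p {x} {y} px py e = trans (sym (enum-rank p x px)) (trans (cong (enum p) e) (enum-rank p y py))

  count-≤-injection : ∀ {n m} (p : Fin n → Bool) (q : Fin m → Bool) (f : ∀ x → p x ≡ true → Fin m) →
    (∀ x px → q (f x px) ≡ true) →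
    (∀ x y px py → f x px ≡ f y py → x ≡ y) → count p ≤ count q
  count-≤-injection p q f f∈q f-inj = injective⇒≤ {f = f′} f′-inj
    where
    f′ : Fin (count p) → Fin (count q)
    f′ i = rank q (f (enum p i) (enum-true p i)) (f∈q _ _)
    f′-inj : ∀ {i j} → f′ i ≡ f′ j → i ≡ j
    f′-inj e = enum-injective p (f-inj _ _ _ _ (rank-injective q _ _ e))

  count-≤-map : ∀ {n m} (p : Fin n → Bool) (q : Fin m → Bool) (f : Fin n → Fin m) →
    (∀ x → p x ≡ true → q (f x) ≡ true) →
    (∀ x y → p x ≡ true → p y ≡ true → f x ≡ f y → x ≡ y) → count p ≤ count q
  count-≤-map p q f f∈q f-inj = count-≤-injection p q (λ x _ → f x) f∈q (λ x y px py → f-inj x y px py)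

  count+count≤count-by-disjoint-injections : ∀ {n m} (p r : Fin n → Bool) (q : Fin m → Bool) (f g : Fin n → Fin m) →
    (∀ x → p x ≡ true → q (f x) ≡ true) →
    (∀ x → r x ≡ true → q (g x) ≡ true) →
    (∀ x y → p x ≡ true → p y ≡ true → f x ≡ f y → x ≡ y) →
    (∀ x y → r x ≡ true → r y ≡ true → g x ≡ g y → x ≡ y) →
    (∀ x y → p x ≡ true → r y ≡ true → f x ≢ g y) →
    count p + count r ≤ count q
  count+count≤count-by-disjoint-injections p r q f g f∈q g∈q f-inj g-inj f≢g = injective⇒≤ {f = h} h-inj
    where
    h⊎ : Fin (count p) ⊎ Fin (count r) → Fin (count q)
    h⊎ (inj₁ i) = rank q (f (enum p i)) (f∈q _ (enum-true p i))
    h⊎ (inj₂ i) = rank q (g (enum r i)) (g∈q _ (enum-true r i))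
    h⊎-inj : ∀ a b → h⊎ a ≡ h⊎ b → a ≡ b
    h⊎-inj (inj₁ i) (inj₁ j) e = cong inj₁ (enum-injective p (f-inj _ _ (enum-true p i) (enum-true p j) (rank-injective q _ _ e)))
    h⊎-inj (inj₂ i) (inj₂ j) e = cong inj₂ (enum-injective r (g-inj _ _ (enum-true r i) (enum-true r j) (rank-injective q _ _ e)))
    h⊎-inj (inj₁ i) (inj₂ j) e = ⊥-elim (f≢g _ _ (enum-true p i) (enum-true r j) (rank-injective q _ _ e))
    h⊎-inj (inj₂ i) (inj₁ j) e = ⊥-elim (f≢g _ _ (enum-true p j) (enum-true r i) (sym (rank-injective q _ _ e)))
    h : Fin (count p + count r) → Fin (count q)
    h i = h⊎ (splitAt (count p) i)
    h-inj : ∀ {i j} → h i ≡ h j → i ≡ j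
    h-inj {i} {j} e = begin
      i                                        ≡⟨ join-splitAt (count p) (count r) i ⟨
      join (count p) (count r) (splitAt (count p) i)  ≡⟨ cong (join (count p) (count r)) (h⊎-inj (splitAt (count p) i) (splitAt (count p) j) e) ⟩
      join (count p) (count r) (splitAt (count p) j)           ≡⟨ join-splitAt (count p) (count r) j ⟩
      j                                        ∎
      where open ≡-Reasoning

  anyᵇ : ∀ {n} → (Fin n → Bool) → Bool
  anyᵇ {zero} p = false
  anyᵇ {suc n} p = p zero ∨ anyᵇ (λ i → p (suc i))

  anyᵇ-intro : ∀ {n} (p : Fin n → Bool) x → p x ≡ true → anyᵇ p ≡ true
  anyᵇ-intro p zero px rewrite px = refl
  anyᵇ-intro p (suc x) px with p zero
  ... | true = refl
  ... | false = anyᵇ-intro (λ i → p (suc i)) x px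

  anyᵇ-elim : ∀ {n} (p : Fin n → Bool) → anyᵇ p ≡ true → Σ (Fin n) (λ x → p x ≡ true)
  anyᵇ-elim {suc n} p any with p zero in eq
  ... | true = zero , eq
  ... | false with anyᵇ-elim (λ i → p (suc i)) any
  ... | x , px = suc x , px

  1<count⇒two-distinct : ∀ {n} (p : Fin n → Bool) → 1 < count p →
    Σ (Fin n) λ x → Σ (Fin n) λ y → x ≢ y × p x ≡ true × p y ≡ true
  1<count⇒two-distinct p 1<count = enum p first , enum p second , distinct , enum-true p first , enum-true p second
    where
    first second : Fin (count p)
    first = fromℕ< (<-trans z<s 1<count)
    second = fromℕ< 1<count
    distinct : enum p first ≢ enum p second
    distinct e with () ← trans (sym (toℕ-fromℕ< (<-trans z<s 1<count))) (trans (cong toℕ (enum-injective p e)) (toℕ-fromℕ< 1<count))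

module VertexSets where

  open import Defs hiding (sym)
  open Counting
  open import Data.Bool using (Bool; true; false; _∧_)
  open import Data.Empty using (⊥-elim)
  open import Data.Fin using (Fin; _≟_)
  open import Data.Fin.Subset using (Subset; _∈_; ∣_∣)
  open import Data.Integer using (ℤ; +_; _-_)
  open import Data.Nat using (ℕ; suc; _≤_)
  open import Data.Nat.Properties using (≤-antisym)
  open import Data.Product using (Σ; Σ-syntax; _×_; _,_; proj₁; proj₂)
  open import Data.Vec using ([]; _∷_; lookup; tabulate)
  open import Data.Vec.Properties using (lookup∘tabulate; []=⇒lookup; lookup⇒[]=)
  open import Relation.Binary.PropositionalEquality
  open import Relation.Nullary using (does; yes; no)

  VSet : ℕ → Set
  VSet n = Fin n → Bool

  _⊆ᵥ_ : ∀ {n} → VSet n → VSet n → Set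
  S ⊆ᵥ X = ∀ i → S i ≡ true → X i ≡ true

  Stableᵥ : ∀ {n} → Graph n → VSet n → Set
  Stableᵥ G S = ∀ i j → S i ≡ true → S j ≡ true → adj G i j ≡ false

  -- α, θ and the gap of the subgraph induced on X, stated without leaving the vertex set of G.
  IsAlphaOn : ∀ {n} → Graph n → VSet n → ℕ → Set
  IsAlphaOn {n} G X a =
    (Σ[ S ∈ VSet n ] (S ⊆ᵥ X × Stableᵥ G S × count S ≡ a)) × (∀ S → S ⊆ᵥ X → Stableᵥ G S → count S ≤ a)

  CliquePartitionOn : ∀ {n} → Graph n → VSet n → ℕ → Set
  CliquePartitionOn {n} G X t =
    Σ[ c ∈ (∀ i → X i ≡ true → Fin t) ] (∀ i j xi xj → c i xi ≡ c j xj → i ≢ j → Edge G i j)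

  IsThetaOn : ∀ {n} → Graph n → VSet n → ℕ → Set
  IsThetaOn G X t = CliquePartitionOn G X t × (∀ k → CliquePartitionOn G X k → t ≤ k)

  HasGapOn : ∀ {n} → Graph n → VSet n → ℤ → Set
  HasGapOn G X g = Σ[ a ∈ ℕ ] Σ[ t ∈ ℕ ] (IsAlphaOn G X a × IsThetaOn G X t × g ≡ + t - + a)

  ∣S∣≡count : ∀ {n} (S : Subset n) → ∣ S ∣ ≡ count (lookup S)
  ∣S∣≡count [] = refl
  ∣S∣≡count (true ∷ S) = cong suc (∣S∣≡count S)
  ∣S∣≡count (false ∷ S) = ∣S∣≡count S

  ∈⇒lookup : ∀ {n} {x : Fin n} {S : Subset n} → x ∈ S → lookup S x ≡ true
  ∈⇒lookup = []=⇒lookup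

  lookup⇒∈ : ∀ {n} {x : Fin n} {S : Subset n} → lookup S x ≡ true → x ∈ S
  lookup⇒∈ {x = x} {S} = lookup⇒[]= x S

  record Enumerates {m n} (f : Fin m → Fin n) (X : VSet n) : Set where
    field
      injective : ∀ x y → f x ≡ f y → x ≡ y
      into : ∀ x → X (f x) ≡ true
      onto : ∀ y → X y ≡ true → Σ (Fin m) (λ x → f x ≡ y)
  open Enumerates

  enum-enumerates : ∀ {n} (X : VSet n) → Enumerates (enum X) X
  enum-enumerates X = record
    { injective = λ _ _ → enum-injective X
    ; into = enum-true X
    ; onto = λ y xy → rank X y xy , enum-rank X y xy }

  module Induced {m n} (G : Graph n) {f : Fin m → Fin n} {X : VSet n} (E : Enumerates f X) where

    H : Graph m
    H = induce G f

    preimage : ∀ y → X y ≡ true → Fin m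
    preimage y xy = proj₁ (onto E y xy)

    f-preimage : ∀ y xy → f (preimage y xy) ≡ y
    f-preimage y xy = proj₂ (onto E y xy)

    stableᵥ⇒stable : (S : VSet n) → S ⊆ᵥ X → Stableᵥ G S → Σ[ S′ ∈ Subset m ] (Stable H S′ × ∣ S′ ∣ ≡ count S)
    stableᵥ⇒stable S S⊆X stable = S′ , stable′ , size
      where
      S′ : Subset m
      S′ = tabulate (λ x → S (f x))
      lookup-S′ : ∀ {x} → x ∈ S′ → S (f x) ≡ true
      lookup-S′ {x} x∈ = trans (sym (lookup∘tabulate _ x)) (∈⇒lookup x∈)
      stable′ : Stable H S′
      stable′ i j i∈ j∈ = stable (f i) (f j) (lookup-S′ i∈) (lookup-S′ j∈)
      size : ∣ S′ ∣ ≡ count S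
      size = trans (∣S∣≡count S′) (trans (count-cong (lookup∘tabulate (λ x → S (f x)))) (≤-antisym
        (count-≤-map (λ x → S (f x)) S f (λ _ sfx → sfx) (λ x y _ _ → injective E x y))
        (count-≤-injection S (λ x → S (f x)) (λ y sy → preimage y (S⊆X y sy))
          (λ y sy → subst (λ z → S z ≡ true) (sym (f-preimage y _)) sy)
          (λ y y′ sy sy′ e → trans (sym (f-preimage y _)) (trans (cong f e) (f-preimage y′ _))))))

    image : Subset m → VSet n
    image S′ y = anyᵇ (λ x → lookup S′ x ∧ does (f x ≟ y))

    image-elim : ∀ S′ y → image S′ y ≡ true → Σ (Fin m) (λ x → lookup S′ x ≡ true × f x ≡ y)
    image-elim S′ y y∈ with anyᵇ-elim _ y∈
    ... | x , _ with lookup S′ x in x∈ | f x ≟ y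
    image-elim S′ y y∈ | x , _ | true | yes fx≡y = x , x∈ , fx≡y

    image-intro : ∀ S′ x → lookup S′ x ≡ true → image S′ (f x) ≡ true
    image-intro S′ x x∈ with f x ≟ f x in fx≟fx
    ... | yes _ = anyᵇ-intro _ x (cong₂ _∧_ x∈ (cong does fx≟fx))
    ... | no fx≢fx = ⊥-elim (fx≢fx refl)

    stable⇒stableᵥ : (S′ : Subset m) → Stable H S′ → (image S′ ⊆ᵥ X) × Stableᵥ G (image S′) × count (image S′) ≡ ∣ S′ ∣
    stable⇒stableᵥ S′ stable = image⊆X , stableᵥ , trans (≤-antisym size≤ size≥) (sym (∣S∣≡count S′))
      where
      image⊆X : image S′ ⊆ᵥ X
      image⊆X y y∈ with image-elim S′ y y∈
      ... | x , _ , refl = into E x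
      stableᵥ : Stableᵥ G (image S′)
      stableᵥ i j i∈ j∈ with image-elim S′ i i∈ | image-elim S′ j j∈
      ... | x , x∈ , refl | x′ , x′∈ , refl = stable x x′ (lookup⇒∈ x∈) (lookup⇒∈ x′∈)
      size≤ : count (image S′) ≤ count (lookup S′)
      size≤ = count-≤-injection (image S′) (lookup S′) (λ y y∈ → proj₁ (image-elim S′ y y∈))
        (λ y y∈ → proj₁ (proj₂ (image-elim S′ y y∈)))
        (λ y y′ y∈ y′∈ e → trans (sym (proj₂ (proj₂ (image-elim S′ y y∈))))
                                   (trans (cong f e) (proj₂ (proj₂ (image-elim S′ y′ y′∈)))))
      size≥ : count (lookup S′) ≤ count (image S′)
      size≥ = count-≤-map (lookup S′) (image S′) f (image-intro S′) (λ x y _ _ → injective E x y)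

    partitionOn⇒partition : ∀ {t} → CliquePartitionOn G X t → CliquePartition H t
    partitionOn⇒partition (c , clique) =
      (λ x → c (f x) (into E x)) , λ i j e i≢j → clique (f i) (f j) _ _ e (λ q → i≢j (injective E i j q))

    partition⇒partitionOn : ∀ {t} → CliquePartition H t → CliquePartitionOn G X t
    partition⇒partitionOn (c , clique) = (λ y xy → c (preimage y xy)) , clique′
      where
      clique′ : ∀ i j xi xj → c (preimage i xi) ≡ c (preimage j xj) → i ≢ j → Edge G i j
      clique′ i j xi xj e i≢j with onto E i xi | onto E j xj
      ... | x , refl | x′ , refl = clique x x′ e (λ q → i≢j (cong f q))

    isAlphaOn⇒isAlpha : ∀ {a} → IsAlphaOn G X a → IsAlpha H a
    isAlphaOn⇒isAlpha ((S , S⊆X , stable , size) , maximal) with stableᵥ⇒stable S S⊆X stable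
    ... | S′ , stable′ , size′ = (S′ , stable′ , trans size′ size) , λ T stableT →
      let (T⊆X , stableᵥT , sizeT) = stable⇒stableᵥ T stableT in subst (_≤ _) sizeT (maximal _ T⊆X stableᵥT)

    isAlpha⇒isAlphaOn : ∀ {a} → IsAlpha H a → IsAlphaOn G X a
    isAlpha⇒isAlphaOn ((S′ , stable′ , size′) , maximal) with stable⇒stableᵥ S′ stable′
    ... | S⊆X , stable , size = (image S′ , S⊆X , stable , trans size size′) , λ T T⊆X stableT →
      let (T′ , stableT′ , sizeT′) = stableᵥ⇒stable T T⊆X stableT in subst (_≤ _) sizeT′ (maximal T′ stableT′)

    hasGapOn⇒hasGap : ∀ {g} → HasGapOn G X g → HasGap H g
    hasGapOn⇒hasGap (a , t , A , (P , minimal) , g≡) =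
      a , t , isAlphaOn⇒isAlpha A , (partitionOn⇒partition P , λ k Q → minimal k (partition⇒partitionOn Q)) , g≡

    hasGap⇒hasGapOn : ∀ {g} → HasGap H g → HasGapOn G X g
    hasGap⇒hasGapOn (a , t , A , (P , minimal) , g≡) =
      a , t , isAlpha⇒isAlphaOn A , (partition⇒partitionOn P , λ k Q → minimal k (partitionOn⇒partition Q)) , g≡

  hasGapOn-all⇒hasGap : ∀ {n} (G : Graph n) {g} → HasGapOn G (λ _ → true) g → HasGap G g
  hasGapOn-all⇒hasGap G = Induced.hasGapOn⇒hasGap G identity-enumerates
    where
    identity-enumerates : Enumerates (λ x → x) (λ _ → true)
    identity-enumerates = record { injective = λ _ _ e → e ; into = λ _ → refl ; onto = λ y _ → y , refl }

  induce-triangleFree : ∀ {m n} (G : Graph n) (f : Fin m → Fin n) → TriangleFree G → TriangleFree (induce G f)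
  induce-triangleFree G f triangle-free i j k = triangle-free (f i) (f j) (f k)

  isAlphaOn≤isAlpha : ∀ {n} {G : Graph n} {X : VSet n} {a′ a} → IsAlphaOn G X a′ → IsAlpha G a → a′ ≤ a
  isAlphaOn≤isAlpha {G = G} {a = a} ((S , _ , stable , refl) , _) (_ , maximal) = subst (_≤ a) size (maximal (tabulate S) stable′)
    where
    lookup-S : ∀ {i} → i ∈ tabulate S → S i ≡ true
    lookup-S {i} i∈ = trans (sym (lookup∘tabulate S i)) (∈⇒lookup i∈)
    stable′ : Stable G (tabulate S)
    stable′ i j i∈ j∈ = stable i j (lookup-S i∈) (lookup-S j∈)
    size : ∣ tabulate S ∣ ≡ count S
    size = trans (∣S∣≡count (tabulate S)) (count-cong (lookup∘tabulate S))

module Existence where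

  open import Defs hiding (sym)
  open Counting
  open VertexSets
  open import Data.Bool.Properties using () renaming (_≟_ to _≟ᵇ_)
  open import Data.Bool using (false; true)
  open import Data.Empty using (⊥-elim)
  open import Data.Fin using (Fin; zero; suc; _≟_)
  open import Data.Fin.Properties using (any?; all?)
  open import Data.Fin.Subset using (Subset; ∣_∣)
  import Data.Fin.Subset as Subset
  open import Data.Fin.Subset.Properties using (anySubset?; _∈?_; ∣p∣≤n; ∉⊥; ∣⊥∣≡0)
  open import Data.Integer using (ℤ; +_; _-_)
  open import Data.Nat using (ℕ; zero; suc; _+_; _≤_; _<_)
  import Data.Nat as ℕ
  open import Data.Nat.Properties using (≤-pred; ≤∧≢⇒<; ≮⇒≥; +-identityʳ; +-suc; m<1+n⇒m<n∨m≡n; ≤-antisym)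
  open import Data.Product using (Σ; Σ-syntax; _×_; _,_)
  open import Data.Sum using ([_,_])
  open import Data.Vec.Functional using (_∷_)
  open import Relation.Binary.PropositionalEquality hiding ([_])
  open import Relation.Nullary using (Dec; yes; no; ¬_)
  open import Relation.Nullary.Decidable using (_×-dec_; _→-dec_; ¬?)

  greatest : (Q : ℕ → Set) → (∀ a → Dec (Q a)) → ∀ b → (∀ c → Q c → c ≤ b) → Q 0 →
    Σ ℕ λ a → Q a × (∀ c → Q c → c ≤ a)
  greatest Q Q? b bound q0 with Q? b
  ... | yes qb = b , qb , bound
  greatest Q Q? zero bound q0 | no ¬qb = ⊥-elim (¬qb q0)
  greatest Q Q? (suc b) bound q0 | no ¬qb =
    greatest Q Q? b (λ c qc → ≤-pred (≤∧≢⇒< (bound c qc) (λ c≡ → ¬qb (subst Q c≡ qc)))) q0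

  least : (Q : ℕ → Set) → (∀ a → Dec (Q a)) → ∀ m → Q m → Σ ℕ λ k → Q k × (∀ j → Q j → k ≤ j)
  least Q Q? m qm = search m 0 refl (λ _ ())
    where
    search : ∀ r b → b + r ≡ m → (∀ j → j < b → ¬ Q j) → Σ ℕ λ k → Q k × (∀ j → Q j → k ≤ j)
    search r b b+r≡m below with Q? b
    ... | yes qb = b , qb , λ j qj → ≮⇒≥ (λ j<b → below j j<b qj)
    search zero b b+r≡m below | no ¬qb = ⊥-elim (¬qb (subst Q (trans (sym b+r≡m) (+-identityʳ b)) qm))
    search (suc r) b b+r≡m below | no ¬qb = search r (suc b) (trans (sym (+-suc b r)) b+r≡m)
      λ j j<1+b → [ below j , (λ j≡b qj → ¬qb (subst Q j≡b qj)) ] (m<1+n⇒m<n∨m≡n j<1+b)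

  anyFunction? : ∀ {n k} (P : (Fin n → Fin k) → Set) → (∀ f g → (∀ x → f x ≡ g x) → P f → P g) →
    (∀ f → Dec (P f)) → Dec (Σ (Fin n → Fin k) P)
  anyFunction? {zero} P P-cong P? with P? (λ ())
  ... | yes p = yes (_ , p)
  ... | no ¬p = no λ { (f , pf) → ¬p (P-cong f _ (λ ()) pf) }
  anyFunction? {suc n} P P-cong P?
    with any? (λ a → anyFunction? (λ g → P (a ∷ g)) (λ f g f≗g → P-cong _ _ (λ { zero → refl ; (suc i) → f≗g i }))
                                   (λ g → P? (a ∷ g)))
  ... | yes (a , g , p) = yes (a ∷ g , p)
  ... | no ¬p = no λ { (f , pf) → ¬p (f zero , (λ i → f (suc i)) , P-cong f _ (λ { zero → refl ; (suc i) → refl }) pf) }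

  stable? : ∀ {n} (G : Graph n) (S : Subset n) → Dec (Stable G S)
  stable? G S = all? λ i → all? λ j → (i ∈? S) →-dec ((j ∈? S) →-dec (adj G i j ≟ᵇ false))

  cliquePartition? : ∀ {n} (G : Graph n) k → Dec (CliquePartition G k)
  cliquePartition? G k =
    anyFunction? _ (λ f g f≗g clique i j e i≢j → clique i j (trans (f≗g i) (trans e (sym (f≗g j)))) i≢j)
      (λ c → all? λ i → all? λ j → (c i ≟ c j) →-dec (¬? (i ≟ j) →-dec (adj G i j ≟ᵇ true)))

  -- Opaque, so that the exhaustive searches are never unfolded during type checking.
  opaque
    hasAlpha : ∀ {n} (G : Graph n) → Σ ℕ (IsAlpha G)
    hasAlpha {n} G with greatest (λ a → Σ[ S ∈ Subset n ] (Stable G S × ∣ S ∣ ≡ a))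
        (λ a → anySubset? (λ S → stable? G S ×-dec (∣ S ∣ ℕ.≟ a))) n
        (λ { _ (S , _ , refl) → ∣p∣≤n S }) (Subset.⊥ , (λ _ _ i∈ → ⊥-elim (∉⊥ i∈)) , ∣⊥∣≡0 n)
    ... | a , witness , maximal = a , witness , λ S stable → maximal ∣ S ∣ (S , stable , refl)

    hasTheta : ∀ {n} (G : Graph n) → Σ ℕ (IsTheta G)
    hasTheta {n} G = least (CliquePartition G) (cliquePartition? G) n ((λ x → x) , λ _ _ e i≢j → ⊥-elim (i≢j e))

    hasGap : ∀ {n} (G : Graph n) → Σ ℤ (HasGap G)
    hasGap G with hasAlpha G | hasTheta G
    ... | a , A | t , T = _ , a , t , A , T , refl

    hasGapOn : ∀ {n} (G : Graph n) (X : VSet n) → Σ ℤ (HasGapOn G X)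
    hasGapOn G X with hasGap (induce G (enum X))
    ... | g , h = g , Induced.hasGap⇒hasGapOn G (enum-enumerates X) h

  isAlpha-unique : ∀ {n} {G : Graph n} {a b} → IsAlpha G a → IsAlpha G b → a ≡ b
  isAlpha-unique ((S , stable , refl) , maximal) ((S′ , stable′ , refl) , maximal′) =
    ≤-antisym (maximal′ S stable) (maximal S′ stable′)

  isTheta-unique : ∀ {n} {G : Graph n} {a b} → IsTheta G a → IsTheta G b → a ≡ b
  isTheta-unique {a = a} {b} (P , minimal) (P′ , minimal′) = ≤-antisym (minimal b P′) (minimal′ a P)

  hasGap-unique : ∀ {n} {G : Graph n} {g h} → HasGap G g → HasGap G h → g ≡ h
  hasGap-unique {G = G} (a , t , A , T , refl) (a′ , t′ , A′ , T′ , refl) =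
    cong₂ (λ x y → + x - + y) (isTheta-unique {G = G} T T′) (isAlpha-unique {G = G} A A′)

module Arithmetic where

  open import Data.Integer using (ℤ; +_; _-_; _+_; -_; +≤+)
  import Data.Integer as ℤ
  open import Data.Integer.Properties using (pos-+; +-comm; +-monoˡ-≤; +-monoˡ-<; drop‿+≤+; drop‿+<+)
  open import Data.Integer.Solver using (module +-*-Solver)
  open import Data.Nat using (ℕ; zero; suc; ⌈_/2⌉; z≤n; s≤s)
  import Data.Nat as ℕ
  import Data.Nat.Properties as ℕ
  open import Relation.Binary.PropositionalEquality
  open +-*-Solver

  n≤t+t⇒⌈n/2⌉≤t : ∀ n t → n ℕ.≤ t ℕ.+ t → ⌈ n /2⌉ ℕ.≤ t
  n≤t+t⇒⌈n/2⌉≤t zero t _ = z≤n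
  n≤t+t⇒⌈n/2⌉≤t (suc zero) (suc t) _ = s≤s z≤n
  n≤t+t⇒⌈n/2⌉≤t (suc (suc n)) (suc t) (s≤s n+2≤t+t+2) =
    s≤s (n≤t+t⇒⌈n/2⌉≤t n t (ℕ.≤-pred (ℕ.≤-trans n+2≤t+t+2 (ℕ.≤-reflexive (ℕ.+-suc t t)))))

  t+t≤1+n⇒t≤⌈n/2⌉ : ∀ n t → t ℕ.+ t ℕ.≤ suc n → t ℕ.≤ ⌈ n /2⌉
  t+t≤1+n⇒t≤⌈n/2⌉ n zero _ = z≤n
  t+t≤1+n⇒t≤⌈n/2⌉ (suc zero) (suc zero) _ = s≤s z≤n
  t+t≤1+n⇒t≤⌈n/2⌉ (suc (suc n)) (suc t) (s≤s t+t+1≤n+2) =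
    s≤s (t+t≤1+n⇒t≤⌈n/2⌉ n t (ℕ.≤-pred (ℕ.≤-trans (ℕ.≤-reflexive (sym (ℕ.+-suc t t))) t+t+1≤n+2)))
  t+t≤1+n⇒t≤⌈n/2⌉ zero (suc t) (s≤s t+t+1≤0) with () ← ℕ.≤-trans (ℕ.≤-reflexive (sym (ℕ.+-suc t t))) t+t+1≤0
  t+t≤1+n⇒t≤⌈n/2⌉ (suc zero) (suc (suc t)) (s≤s (s≤s t+t+2≤0))
    with () ← ℕ.≤-trans (ℕ.≤-reflexive (sym (ℕ.+-suc t (suc t)))) t+t+2≤0

  private
    diff+sum : ∀ x y w → (+ x - + y) + (+ y + + w) ≡ + (x ℕ.+ w)
    diff+sum x y w = trans (solve 3 (λ a b c → (a :- b) :+ (b :+ c) := a :+ c) refl (+ x) (+ y) (+ w)) (sym (pos-+ x w))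

    sum-sum : ∀ x y w → + (x ℕ.+ w) - (+ y + + w) ≡ + x - + y
    sum-sum x y w = trans (cong (_- (+ y + + w)) (pos-+ x w)) (solve 3 (λ a b c → (a :+ c) :- (b :+ c) := a :- b) refl (+ x) (+ y) (+ w))

    swap-sum : ∀ z w y → (+ z - + w) + (+ y + + w) ≡ + (z ℕ.+ y)
    swap-sum z w y = trans (cong (λ s → (+ z - + w) + s) (+-comm (+ y) (+ w))) (diff+sum z w y)

  diff≤diff⇒ : ∀ {x y z w} → + x - + y ℤ.≤ + z - + w → x ℕ.+ w ℕ.≤ z ℕ.+ y
  diff≤diff⇒ {x} {y} {z} {w} ≤ = drop‿+≤+ (subst₂ ℤ._≤_ (diff+sum x y w) (swap-sum z w y) (+-monoˡ-≤ (+ y + + w) ≤))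

  diff<diff⇒ : ∀ {x y z w} → + x - + y ℤ.< + z - + w → x ℕ.+ w ℕ.< z ℕ.+ y
  diff<diff⇒ {x} {y} {z} {w} < = drop‿+<+ (subst₂ ℤ._<_ (diff+sum x y w) (swap-sum z w y) (+-monoˡ-< (+ y + + w) <))

  diff≤diff⇐ : ∀ {x y z w} → x ℕ.+ w ℕ.≤ z ℕ.+ y → + x - + y ℤ.≤ + z - + w
  diff≤diff⇐ {x} {y} {z} {w} ≤ = subst₂ ℤ._≤_ (sum-sum x y w) (trans (cong (λ s → + (z ℕ.+ y) - s) (+-comm (+ y) (+ w))) (sum-sum z w y))
    (+-monoˡ-≤ (- (+ y + + w)) (+≤+ ≤))

  diff≡diff⇐ : ∀ {x y z w} → x ℕ.+ w ≡ z ℕ.+ y → + x - + y ≡ + z - + w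
  diff≡diff⇐ {x} {y} {z} {w} e = trans (sym (sum-sum x y w))
    (trans (cong (λ s → + s - (+ y + + w)) e) (trans (cong (λ s → + (z ℕ.+ y) - s) (+-comm (+ y) (+ w))) (sum-sum z w y)))

  +-cancelʳ-≤ᶻ : ∀ {x y} r → x + r ℤ.≤ y + r → x ℤ.≤ y
  +-cancelʳ-≤ᶻ {x} {y} r ≤ = subst₂ ℤ._≤_ (cancel x) (cancel y) (+-monoˡ-≤ (- r) ≤)
    where
    cancel : ∀ z → z + r + - r ≡ z
    cancel z = solve 2 (λ a b → a :+ b :+ (:- b) := a) refl z r

module Deletion where

  open import Defs hiding (sym)
  open VertexSets
  open import Data.Bool using (not; true)
  open import Data.Empty using (⊥-elim)
  open import Data.Fin using (Fin; _≟_; punchIn; punchOut; fromℕ; inject₁)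
  open import Data.Fin.Properties using (punchIn-injective; punchInᵢ≢i; punchIn-punchOut; fromℕ≢inject₁; inject₁-injective)
  open import Data.Nat using (suc; _+_; _≤_; _<_; s≤s)
  open import Data.Nat.Properties using (≤-pred; ≤-trans; +-monoʳ-≤; +-monoˡ-≤)
  open import Data.Product using (_,_; proj₁)
  open import Relation.Binary.PropositionalEquality
  open import Relation.Nullary using (does; yes; no)
  open import Relation.Nullary.Decidable using (dec-false)

  module VertexDeletion {n} (G : Graph (suc n)) (w : Fin (suc n)) where

    G-w : Graph n
    G-w = induce G (punchIn w)

    others : VSet (suc n)
    others y = not (does (y ≟ w))

    punchIn-enumerates : Enumerates (punchIn w) others
    punchIn-enumerates = record
      { injective = punchIn-injective w
      ; into = λ x → cong not (dec-false (punchIn w x ≟ w) (punchInᵢ≢i w x))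
      ; onto = λ y y≢w → punchOut (w≢ y y≢w) , punchIn-punchOut {i = w} (w≢ y y≢w) }
      where
      w≢ : ∀ y → others y ≡ true → w ≢ y
      w≢ y y∈ refl with y ≟ y | y∈
      ... | yes _ | ()
      ... | no y≢y | _ = y≢y refl

    α-deletion≤α : ∀ {a a′} → IsAlpha G a → IsAlpha G-w a′ → a′ ≤ a
    α-deletion≤α A A′ = isAlphaOn≤isAlpha {G = G} {X = others} (Induced.isAlpha⇒isAlphaOn G punchIn-enumerates A′) A

    addSingleton : ∀ {t′} → CliquePartition G-w t′ → CliquePartition G (suc t′)
    addSingleton {t′} (c′ , clique′) = c , clique
      where
      c : Fin (suc n) → Fin (suc t′)
      c y with w ≟ y
      ... | yes _ = fromℕ t′
      ... | no w≢y = inject₁ (c′ (punchOut w≢y))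
      clique : ∀ y z → c y ≡ c z → y ≢ z → Edge G y z
      clique y z cy≡cz y≢z with w ≟ y | w ≟ z
      ... | yes refl | yes refl = ⊥-elim (y≢z refl)
      ... | yes _ | no _ = ⊥-elim (fromℕ≢inject₁ cy≡cz)
      ... | no _ | yes _ = ⊥-elim (fromℕ≢inject₁ (sym cy≡cz))
      ... | no w≢y | no w≢z = subst₂ (Edge G) (punchIn-punchOut w≢y) (punchIn-punchOut w≢z)
        (clique′ _ _ (inject₁-injective cy≡cz) (λ q → y≢z (trans (sym (punchIn-punchOut w≢y)) (trans (cong (punchIn w) q) (punchIn-punchOut w≢z)))))

    addSingleton-alone : ∀ {t′} (P : CliquePartition G-w t′) y → proj₁ (addSingleton P) y ≡ proj₁ (addSingleton P) w → y ≡ w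
    addSingleton-alone P y cy≡cw with w ≟ y | w ≟ w
    ... | yes w≡y | _ = sym w≡y
    ... | no _ | yes _ = ⊥-elim (fromℕ≢inject₁ (sym cy≡cw))
    ... | _ | no w≢w = ⊥-elim (w≢w refl)

    θ≤1+θ-deletion : ∀ {t t′} → IsTheta G t → IsTheta G-w t′ → t ≤ suc t′
    θ≤1+θ-deletion (_ , minimal) (P′ , _) = minimal _ (addSingleton P′)

    gap>⇒deletion-gap≥ : ∀ {a t a′ t′} → IsAlpha G a → IsTheta G t → IsAlpha G-w a′ → IsTheta G-w t′ →
      ∀ a₀ t₀ → t₀ + a < t + a₀ → t₀ + a′ ≤ t′ + a₀
    gap>⇒deletion-gap≥ A T A′ T′ a₀ t₀ above =
      ≤-pred (≤-trans (s≤s (+-monoʳ-≤ t₀ (α-deletion≤α A A′))) (≤-trans above (+-monoˡ-≤ a₀ (θ≤1+θ-deletion T T′))))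

module Matchings where

  open import Defs hiding (sym)
  open Counting
  open import Data.Bool using (Bool; true; false; if_then_else_)
  open import Data.Empty using (⊥-elim)
  open import Data.Fin using (Fin; _≟_; _<?_; _≤?_; splitAt; _↑ˡ_; _↑ʳ_)
  import Data.Fin as Fin
  open import Data.Fin.Properties using (any?; splitAt-↑ˡ; splitAt-↑ʳ; <-cmp; <⇒≢; ≤-antisym)
  import Data.Fin.Properties as FinProps
  open import Data.Nat using (ℕ; _+_; _≤_; _<_)
  open import Data.Nat.Properties using (≤-refl; ≤-trans; ≤-reflexive; +-monoʳ-≤; +-assoc; +-comm; +-identityʳ; <⇒≤; ≰⇒>)
  open import Data.Product using (Σ; ∃; _×_; _,_; proj₁; proj₂)
  open import Data.Sum using (_⊎_; inj₁; inj₂)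
  open import Relation.Binary.Definitions using (tri<; tri≈; tri>)
  open import Relation.Binary.PropositionalEquality
  open import Relation.Nullary using (Dec; yes; no; does)
  open import Relation.Nullary.Decidable using (_×-dec_; ¬?; dec-true; dec-false)

  -- A matching is encoded by its mate function, an involution whose non-fixed points are matched along edges.
  record Matching {n} (G : Graph n) : Set where
    field
      mate : Fin n → Fin n
      mate-involutive : ∀ x → mate (mate x) ≡ x
      mate-edge : ∀ x → mate x ≢ x → Edge G x (mate x)
  open Matching public

  exposed : ∀ {n} {G : Graph n} → Matching G → Fin n → Bool
  exposed M x = does (mate M x ≟ x)

  #exposed : ∀ {n} {G : Graph n} → Matching G → ℕ
  #exposed M = count (exposed M)

  copy : ∀ {t} → Bool → Fin t → Fin (t + t)
  copy {t} true k = t ↑ʳ k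
  copy {t} false k = k ↑ˡ t

  copy-injective : ∀ {t} a b (k l : Fin t) → copy a k ≡ copy b l → a ≡ b × k ≡ l
  copy-injective {t} a b k l e = split a b k l (trans (sym (splitAt-copy a k)) (trans (cong (splitAt t) e) (splitAt-copy b l)))
    where
    splitAt-copy : ∀ a k → splitAt t (copy a k) ≡ (if a then inj₂ k else inj₁ k)
    splitAt-copy true k = splitAt-↑ʳ t t k
    splitAt-copy false k = splitAt-↑ˡ t k t
    split : ∀ a b (k l : Fin t) → (if a then inj₂ k else inj₁ k) ≡ (if b then inj₂ l else inj₁ l) → a ≡ b × k ≡ l
    split true true k l refl = refl , refl
    split false false k l refl = refl , refl

  <?-asymmetric : ∀ {n} (x y : Fin n) → x ≢ y → does (y <? x) ≢ does (x <? y)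
  <?-asymmetric x y x≢y e with <-cmp x y
  ... | tri< x<y _ y≮x with () ← trans (sym (dec-false (y <? x) y≮x)) (trans e (dec-true (x <? y) x<y))
  ... | tri≈ _ x≡y _ = x≢y x≡y
  ... | tri> x≮y _ y<x with () ← trans (sym (dec-true (y <? x) y<x)) (trans e (dec-false (x <? y) x≮y))

  -- In a triangle-free graph every clique has at most two vertices, so a clique partition is a matching.
  module PartitionMatching {n t} (G : Graph n) (triangle-free : TriangleFree G) (P : CliquePartition G t) where
    private
      c : Fin n → Fin t
      c = proj₁ P
      clique : ∀ i j → c i ≡ c j → i ≢ j → Edge G i j
      clique = proj₂ P

    classmate? : (x : Fin n) → Dec (∃ λ y → c y ≡ c x × y ≢ x)
    classmate? x = any? (λ y → (c y ≟ c x) ×-dec ¬? (y ≟ x))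

    mate′ : Fin n → Fin n
    mate′ x with classmate? x
    ... | yes (y , _) = y
    ... | no _ = x

    mate′-spec : ∀ x → (Σ (Fin n) λ y → mate′ x ≡ y × c y ≡ c x × y ≢ x) ⊎ (mate′ x ≡ x × (∀ y → c y ≡ c x → y ≡ x))
    mate′-spec x with classmate? x
    ... | yes (y , cy≡cx , y≢x) = inj₁ (y , refl , cy≡cx , y≢x)
    ... | no none = inj₂ (refl , λ y cy≡cx → alone y cy≡cx (y ≟ x))
      where
      alone : ∀ y → c y ≡ c x → Dec (y ≡ x) → y ≡ x
      alone y cy≡cx (yes y≡x) = y≡x
      alone y cy≡cx (no y≢x) = ⊥-elim (none (y , cy≡cx , y≢x))

    classmate-unique : ∀ x y z → c y ≡ c x → c z ≡ c x → y ≢ x → z ≢ x → y ≡ z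
    classmate-unique x y z cy cz y≢x z≢x with y ≟ z
    ... | yes y≡z = y≡z
    ... | no y≢z = ⊥-elim (triangle-free x y z (clique x y (sym cy) (λ q → y≢x (sym q))) (clique y z (trans cy (sym cz)) y≢z)
                                              (clique x z (sym cz) (λ q → z≢x (sym q))))

    unmatched⇒alone : ∀ x → mate′ x ≡ x → ∀ y → c y ≡ c x → y ≡ x
    unmatched⇒alone x mx≡x with mate′-spec x
    ... | inj₁ (y , mx≡y , _ , y≢x) = ⊥-elim (y≢x (trans (sym mx≡y) mx≡x))
    ... | inj₂ (_ , alone) = alone

    alone⇒unmatched : ∀ x → (∀ y → c y ≡ c x → y ≡ x) → mate′ x ≡ x
    alone⇒unmatched x alone with mate′-spec x
    ... | inj₁ (y , _ , cy≡cx , y≢x) = ⊥-elim (y≢x (alone y cy≡cx))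
    ... | inj₂ (mx≡x , _) = mx≡x

    mate′-classmate : ∀ x y → c y ≡ c x → y ≢ x → mate′ x ≡ y
    mate′-classmate x y cy≡cx y≢x with mate′-spec x
    ... | inj₁ (y′ , mx≡y′ , cy′≡cx , y′≢x) = trans mx≡y′ (classmate-unique x y′ y cy′≡cx cy≡cx y′≢x y≢x)
    ... | inj₂ (_ , alone) = ⊥-elim (y≢x (alone y cy≡cx))

    matching : Matching G
    matching = record { mate = mate′ ; mate-involutive = involutive ; mate-edge = edge }
      where
      involutive : ∀ x → mate′ (mate′ x) ≡ x
      involutive x with mate′-spec x
      ... | inj₂ (mx≡x , _) = trans (cong mate′ mx≡x) mx≡x
      ... | inj₁ (y , mx≡y , cy≡cx , y≢x) = trans (cong mate′ mx≡y) (mate′-classmate y x (sym cy≡cx) (λ q → y≢x (sym q)))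
      edge : ∀ x → mate′ x ≢ x → Edge G x (mate′ x)
      edge x mx≢x with mate′-spec x
      ... | inj₂ (mx≡x , _) = ⊥-elim (mx≢x mx≡x)
      ... | inj₁ (y , mx≡y , cy≡cx , y≢x) = subst (Edge G x) (sym mx≡y) (clique x y (sym cy≡cx) (λ q → y≢x (sym q)))

    -- Vertex x is sent to copy [mate x < x] of its class, an exposed vertex also to copy true.
    n+#exposed≤2t : n + #exposed matching ≤ t + t
    n+#exposed≤2t = subst₂ _≤_ (cong (_+ #exposed matching) count-const-true) count-const-true
      (count+count≤count-by-disjoint-injections (λ _ → true) (exposed matching) (λ _ → true) slot spare
        (λ _ _ → refl) (λ _ _ → refl) slot-injective spare-injective slot≢spare)
      where
      later : Fin n → Bool
      later x = does (mate′ x <? x)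
      slot spare : Fin n → Fin (t + t)
      slot x = copy (later x) (c x)
      spare x = copy true (c x)
      slot-injective : ∀ x y → true ≡ true → true ≡ true → slot x ≡ slot y → x ≡ y
      slot-injective x y _ _ e with copy-injective (later x) (later y) (c x) (c y) e | x ≟ y
      ... | _ | yes x≡y = x≡y
      ... | later≡ , cx≡cy | no x≢y = ⊥-elim (<?-asymmetric x y x≢y (begin
        does (y <? x)         ≡⟨ cong (λ z → does (z <? x)) (mate′-classmate x y (sym cx≡cy) (λ q → x≢y (sym q))) ⟨
        later x               ≡⟨ later≡ ⟩
        later y               ≡⟨ cong (λ z → does (z <? y)) (mate′-classmate y x cx≡cy x≢y) ⟩
        does (x <? y)         ∎))
        where open ≡-Reasoning
      spare-injective : ∀ x y → exposed matching x ≡ true → exposed matching y ≡ true → spare x ≡ spare y → x ≡ y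
      spare-injective x y x-exp _ e =
        sym (unmatched⇒alone x (dec-true⁻¹ (mate′ x ≟ x) x-exp) y (sym (proj₂ (copy-injective true true (c x) (c y) e))))
      slot≢spare : ∀ x y → true ≡ true → exposed matching y ≡ true → slot x ≢ spare y
      slot≢spare x y _ y-exp e with copy-injective (later x) true (c x) (c y) e
      ... | later-x , cx≡cy = <⇒≢ (dec-true⁻¹ (mate′ x <? x) later-x) (trans (cong mate′ x≡y) (trans my≡y (sym x≡y)))
        where
        my≡y : mate′ y ≡ y
        my≡y = dec-true⁻¹ (mate′ y ≟ y) y-exp
        x≡y : x ≡ y
        x≡y = unmatched⇒alone y my≡y x cx≡cy

  module MatchingPartition {n} {G : Graph n} (M : Matching G) where
    private
      m : Fin n → Fin n
      m = mate M

    leader : Fin n → Bool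
    leader x = does (x ≤? m x)

    representative : Fin n → Fin n
    representative x with x ≤? m x
    ... | yes _ = x
    ... | no _ = m x

    representative-leader : ∀ x → leader (representative x) ≡ true
    representative-leader x with x ≤? m x
    ... | yes x≤mx = dec-true (x ≤? m x) x≤mx
    ... | no x≰mx = dec-true (m x ≤? m (m x)) (subst (m x Fin.≤_) (sym (mate-involutive M x)) (<⇒≤ (≰⇒> x≰mx)))

    representative-cases : ∀ x → representative x ≡ x ⊎ representative x ≡ m x
    representative-cases x with x ≤? m x
    ... | yes _ = inj₁ refl
    ... | no _ = inj₂ refl

    matched : ∀ x y → y ≡ m x → x ≢ y → Edge G x y
    matched x y y≡mx x≢y = subst (Edge G x) (sym y≡mx) (mate-edge M x (λ q → x≢y (sym (trans y≡mx q))))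

    same-representative⇒edge : ∀ x y → representative x ≡ representative y → x ≢ y → Edge G x y
    same-representative⇒edge x y e x≢y with representative-cases x | representative-cases y
    ... | inj₁ rx | inj₁ ry = ⊥-elim (x≢y (trans (sym rx) (trans e ry)))
    ... | inj₁ rx | inj₂ ry = matched x y (sym (trans (cong m (trans (sym rx) (trans e ry))) (mate-involutive M y))) x≢y
    ... | inj₂ rx | inj₁ ry = matched x y (sym (trans (sym rx) (trans e ry))) x≢y
    ... | inj₂ rx | inj₂ ry = ⊥-elim (x≢y (trans (sym (mate-involutive M x))
                                          (trans (cong m (trans (sym rx) (trans e ry))) (mate-involutive M y))))

    partition : CliquePartition G (count leader)
    partition = (λ x → rank leader (representative x) (representative-leader x))
              , λ x y e → same-representative⇒edge x y (rank-injective leader _ _ e)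

    2#leaders≤n+#exposed : count leader + count leader ≤ n + #exposed M
    2#leaders≤n+#exposed = ≤-trans (+-monoʳ-≤ (count leader) #leader≤#follower)
      (≤-reflexive (trans (count+count≡count+count leader follower (λ _ → true) (exposed M) pointwise)
                          (cong (_+ #exposed M) count-const-true)))
      where
      follower : Fin n → Bool
      follower x = does (m x ≤? x)
      #leader≤#follower : count leader ≤ count follower
      #leader≤#follower = count-≤-map leader follower m
        (λ x lx → trans (cong (λ z → does (z ≤? m x)) (mate-involutive M x)) lx)
        (λ x y _ _ e → trans (sym (mate-involutive M x)) (trans (cong m e) (mate-involutive M y)))
      pointwise : ∀ x → bit (leader x) + bit (follower x) ≡ bit true + bit (exposed M x)
      pointwise x = by-cases (x ≤? m x) (m x ≤? x) (m x ≟ x)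
        where
        by-cases : (x≤mx? : Dec (x Fin.≤ m x)) (mx≤x? : Dec (m x Fin.≤ x)) (mx≡x? : Dec (m x ≡ x)) →
                   bit (does x≤mx?) + bit (does mx≤x?) ≡ bit true + bit (does mx≡x?)
        by-cases (yes _) (yes _) (yes _) = refl
        by-cases (yes x≤mx) (yes mx≤x) (no mx≢x) = ⊥-elim (mx≢x (≤-antisym mx≤x x≤mx))
        by-cases (yes _) (no mx≰x) (yes mx≡x) = ⊥-elim (mx≰x (subst (Fin._≤ x) (sym mx≡x) FinProps.≤-refl))
        by-cases (yes _) (no _) (no _) = refl
        by-cases (no x≰mx) (yes _) (yes mx≡x) = ⊥-elim (x≰mx (subst (x Fin.≤_) (sym mx≡x) FinProps.≤-refl))
        by-cases (no _) (yes _) (no _) = refl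
        by-cases (no x≰mx) (no mx≰x) _ = ⊥-elim (x≰mx (<⇒≤ (≰⇒> mx≰x)))

  module Augment {n} {G : Graph n} (M : Matching G) {u w : Fin n} (u≢w : u ≢ w)
    (u-exposed : mate M u ≡ u) (w-exposed : mate M w ≡ w) (uw : Edge G u w) where
    private
      m : Fin n → Fin n
      m = mate M

    m′ : Fin n → Fin n
    m′ x with x ≟ u | x ≟ w
    ... | yes _ | _ = w
    ... | no _ | yes _ = u
    ... | no _ | no _ = m x

    m′-u : m′ u ≡ w
    m′-u with u ≟ u
    ... | yes _ = refl
    ... | no u≢u = ⊥-elim (u≢u refl)

    m′-w : m′ w ≡ u
    m′-w with w ≟ u | w ≟ w
    ... | yes w≡u | _ = ⊥-elim (u≢w (sym w≡u))
    ... | no _ | yes _ = refl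
    ... | no _ | no w≢w = ⊥-elim (w≢w refl)

    m′-other : ∀ x → x ≢ u → x ≢ w → m′ x ≡ m x
    m′-other x x≢u x≢w with x ≟ u | x ≟ w
    ... | yes x≡u | _ = ⊥-elim (x≢u x≡u)
    ... | no _ | yes x≡w = ⊥-elim (x≢w x≡w)
    ... | no _ | no _ = refl

    mate-avoids : ∀ {x y} → m y ≡ y → x ≢ y → m x ≢ y
    mate-avoids {x} {y} my≡y x≢y mx≡y = x≢y (trans (sym (mate-involutive M x)) (trans (cong m mx≡y) my≡y))

    augmented : Matching G
    augmented = record { mate = m′ ; mate-involutive = involutive ; mate-edge = edge }
      where
      involutive : ∀ x → m′ (m′ x) ≡ x
      involutive x = by-cases (x ≟ u) (x ≟ w)
        where
        by-cases : Dec (x ≡ u) → Dec (x ≡ w) → m′ (m′ x) ≡ x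
        by-cases (yes refl) _ = trans (cong m′ m′-u) m′-w
        by-cases (no _) (yes refl) = trans (cong m′ m′-w) m′-u
        by-cases (no x≢u) (no x≢w) = trans (cong m′ (m′-other x x≢u x≢w))
          (trans (m′-other (m x) (mate-avoids u-exposed x≢u) (mate-avoids w-exposed x≢w)) (mate-involutive M x))
      edge : ∀ x → m′ x ≢ x → Edge G x (m′ x)
      edge x m′x≢x = by-cases (x ≟ u) (x ≟ w)
        where
        by-cases : Dec (x ≡ u) → Dec (x ≡ w) → Edge G x (m′ x)
        by-cases (yes refl) _ = subst (Edge G u) (sym m′-u) uw
        by-cases (no _) (yes refl) = subst (Edge G w) (sym m′-w) (trans (Graph.sym G w u) uw)
        by-cases (no x≢u) (no x≢w) = subst (Edge G x) (sym (m′-other x x≢u x≢w))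
          (mate-edge M x (λ q → m′x≢x (trans (m′-other x x≢u x≢w) q)))

    #exposed-augmented : #exposed augmented + 2 ≤ #exposed M
    #exposed-augmented = subst (_≤ #exposed M) (trans (cong₂ (λ a b → #exposed augmented + a + b) (count-≡ u) (count-≡ w))
                                                      (+-assoc (#exposed augmented) 1 1))
      (count+count+count≤count (exposed augmented) (λ x → does (x ≟ u)) (λ x → does (x ≟ w)) (exposed M) pointwise)
      where
      pointwise : ∀ x → bit (exposed augmented x) + bit (does (x ≟ u)) + bit (does (x ≟ w)) ≤ bit (exposed M x)
      pointwise x = by-cases (x ≟ u) (x ≟ w)
        where
        by-cases : Dec (x ≡ u) → Dec (x ≡ w) →
                   bit (exposed augmented x) + bit (does (x ≟ u)) + bit (does (x ≟ w)) ≤ bit (exposed M x)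
        by-cases (yes refl) (yes u≡w) = ⊥-elim (u≢w u≡w)
        by-cases (yes refl) (no _) rewrite m′-u | dec-false (w ≟ u) (λ q → u≢w (sym q)) | dec-true (u ≟ u) refl
          | dec-false (u ≟ w) u≢w | dec-true (m u ≟ u) u-exposed = ≤-refl
        by-cases (no _) (yes refl) rewrite m′-w | dec-false (u ≟ w) u≢w | dec-true (w ≟ w) refl
          | dec-false (w ≟ u) (λ q → u≢w (sym q)) | dec-true (m w ≟ w) w-exposed = ≤-refl
        by-cases (no x≢u) (no x≢w) rewrite m′-other x x≢u x≢w | dec-false (x ≟ u) x≢u | dec-false (x ≟ w) x≢w
          | +-identityʳ (bit (does (m x ≟ x))) | +-identityʳ (bit (does (m x ≟ x))) = ≤-refl

  module Exchange {n} {G : Graph n} (M N : Matching G) (P : Fin n → Bool)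
    (M-closed : ∀ x → P x ≡ true → P (mate M x) ≡ true) (N-closed : ∀ x → P x ≡ true → P (mate N x) ≡ true) where

    complement-closed : (A : Matching G) → (∀ x → P x ≡ true → P (mate A x) ≡ true) → ∀ x → P x ≡ false → P (mate A x) ≡ false
    complement-closed A closed x px with P (mate A x) in pmx
    ... | false = refl
    ... | true = trans (sym (trans (sym (cong P (mate-involutive A x))) (closed (mate A x) pmx))) px

    combine : (A B : Matching G) → (∀ x → P x ≡ true → P (mate A x) ≡ true) → (∀ x → P x ≡ false → P (mate B x) ≡ false) → Matching G
    combine A B A-closed B-closed = record { mate = mate′ ; mate-involutive = involutive ; mate-edge = edge }
      where
      mate′ : Fin n → Fin n
      mate′ x = if P x then mate A x else mate B x
      involutive : ∀ x → mate′ (mate′ x) ≡ x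
      involutive x with P x in px
      ... | true rewrite A-closed x px = mate-involutive A x
      ... | false rewrite B-closed x px = mate-involutive B x
      edge : ∀ x → mate′ x ≢ x → Edge G x (mate′ x)
      edge x mx≢x with P x
      ... | true = mate-edge A x mx≢x
      ... | false = mate-edge B x mx≢x

    M′ : Matching G
    M′ = combine N M N-closed (complement-closed M M-closed)

    N′ : Matching G
    N′ = combine M N M-closed (complement-closed N N-closed)

    M′-inside : ∀ x → P x ≡ true → mate M′ x ≡ mate N x
    M′-inside x px rewrite px = refl

    M′-outside : ∀ x → P x ≡ false → mate M′ x ≡ mate M x
    M′-outside x px rewrite px = refl

    #exposed-exchange : #exposed M′ + #exposed N′ ≡ #exposed M + #exposed N
    #exposed-exchange = count+count≡count+count (exposed M′) (exposed N′) (exposed M) (exposed N) pointwise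
      where
      pointwise : ∀ x → bit (exposed M′ x) + bit (exposed N′ x) ≡ bit (exposed M x) + bit (exposed N x)
      pointwise x with P x
      ... | true = +-comm (bit (exposed N x)) (bit (exposed M x))
      ... | false = refl

module AlternatingWalk where

  open import Defs hiding (sym)
  open Counting
  open Existence using (least)
  open Matchings
  open import Data.Bool using (Bool; true; false; not; if_then_else_)
  open import Data.Bool.Properties using (not-¬; ¬-not; not-involutive) renaming (_≟_ to _≟ᵇ_)
  open import Data.Empty using (⊥-elim)
  open import Data.Fin using (Fin; _≟_; toℕ; fromℕ<)
  open import Data.Fin.Properties using (toℕ<n; toℕ-fromℕ<; pigeonhole)
  open import Data.Nat using (ℕ; zero; suc; _≤_; _<_; z≤n; s≤s)
  open import Data.Nat.Properties using (≤-refl; ≤-trans; ≤-pred; n<1+n; n≤1+n; m≤n⇒m<n∨m≡n; <⇒≱; ≤-antisym)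
  open import Data.Product using (Σ; _×_; _,_; proj₁; proj₂)
  open import Data.Sum using (inj₁; inj₂)
  open import Relation.Binary.PropositionalEquality
  open import Relation.Nullary using (yes; no; does)
  open import Relation.Nullary.Decidable using (dec-true)

  even : ℕ → Bool
  even zero = true
  even (suc i) = not (even i)

  -- The component of w in the symmetric difference of M and N, traversed from w along M at even and N at odd steps.
  module Walk {n} {G : Graph n} (M N : Matching G) (w : Fin n) (w-N-exposed : mate N w ≡ w) where

    step : ℕ → Fin n → Fin n
    step i x = if even i then mate M x else mate N x

    step-involutive : ∀ i x → step i (step i x) ≡ x
    step-involutive i x with even i
    ... | true = mate-involutive M x
    ... | false = mate-involutive N x

    step-parity : ∀ i j → even i ≡ even j → ∀ x → step i x ≡ step j x
    step-parity i j i≡j x rewrite i≡j = refl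

    step-even : ∀ i → even i ≡ true → ∀ x → step i x ≡ mate M x
    step-even i e x rewrite e = refl

    step-odd : ∀ i → even i ≡ false → ∀ x → step i x ≡ mate N x
    step-odd i e x rewrite e = refl

    walk : ℕ → Fin n
    walk zero = w
    walk (suc i) = step i (walk i)

    walk-back : ∀ i → step i (walk (suc i)) ≡ walk i
    walk-back i = step-involutive i (walk i)

    Stops : ℕ → Set
    Stops l = walk (suc l) ≡ walk l

    shorter : ∀ {j} → Σ ℕ (λ l → l < j × Stops l) → Σ ℕ λ l → l < suc j × Stops l
    shorter (l , l<j , stops) = l , ≤-trans l<j (n≤1+n _) , stops

    -- A repetition walk i ≡ walk j is pushed towards a repetition of two consecutive vertices, either by moving
    -- both ends inwards (odd distance) or both ends one step back (even distance, using that w is N-exposed at 0).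
    repeat⇒stop : ∀ i j → i < j → walk i ≡ walk j → Σ ℕ λ l → l < j × Stops l
    repeat⇒stop i (suc j) i<1+j e with even i ≟ᵇ even j | m≤n⇒m<n∨m≡n (≤-pred i<1+j)
    ... | _ | inj₂ refl = i , n<1+n i , sym e
    ... | yes i≡j | inj₁ i<j with m≤n⇒m<n∨m≡n i<j
    ...   | inj₂ refl = ⊥-elim (not-¬ refl i≡j)
    ...   | inj₁ 1+i<j = shorter (repeat⇒stop (suc i) j 1+i<j
             (trans (cong (step i) e) (trans (step-parity i j i≡j _) (walk-back j))))
    repeat⇒stop zero (suc j) _ e | no 0≢j | inj₁ 0<j = shorter (repeat⇒stop zero j 0<j (begin
      w                       ≡⟨ w-N-exposed ⟨
      mate N w                ≡⟨ cong (mate N) e ⟩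
      mate N (walk (suc j))   ≡⟨ step-odd j j-odd _ ⟨
      step j (walk (suc j))   ≡⟨ walk-back j ⟩
      walk j                  ∎))
      where
      open ≡-Reasoning
      j-odd : even j ≡ false
      j-odd with even j
      ... | true = ⊥-elim (0≢j refl)
      ... | false = refl
    repeat⇒stop (suc i) (suc j) _ e | no 1+i≢j | inj₁ 1+i<j = shorter (repeat⇒stop i j (≤-trans (n≤1+n _) 1+i<j)
      (trans (sym (walk-back i)) (trans (cong (step i) e) (trans (step-parity i j i≡j _) (walk-back j)))))
      where
      i≡j : even i ≡ even j
      i≡j with even i | even j
      ... | true | true = refl
      ... | false | false = refl
      ... | true | false = ⊥-elim (1+i≢j refl)
      ... | false | true = ⊥-elim (1+i≢j refl)

    eventually-stops : Σ ℕ Stops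
    eventually-stops with pigeonhole (n<1+n n) (λ (i : Fin (suc n)) → walk (toℕ i))
    ... | i , j , i<j , e with repeat⇒stop (toℕ i) (toℕ j) i<j e
    ... | l , _ , stops = l , stops

    private
      first-stop : Σ ℕ λ l → Stops l × (∀ j → Stops j → l ≤ j)
      first-stop = least Stops (λ l → walk (suc l) ≟ walk l) (proj₁ eventually-stops)
                         (proj₂ eventually-stops)

    end : ℕ
    end = proj₁ first-stop

    end-stops : Stops end
    end-stops = proj₁ (proj₂ first-stop)

    end-first : ∀ l → Stops l → end ≤ l
    end-first = proj₂ (proj₂ first-stop)

    onWalk : Fin n → Bool
    onWalk x = anyᵇ (λ (i : Fin (suc end)) → does (walk (toℕ i) ≟ x))

    onWalk-intro : ∀ i → i ≤ end → onWalk (walk i) ≡ true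
    onWalk-intro i i≤end = anyᵇ-intro (λ (k : Fin (suc end)) → does (walk (toℕ k) ≟ walk i)) (fromℕ< (s≤s i≤end))
      (dec-true (walk (toℕ (fromℕ< (s≤s i≤end))) ≟ walk i) (cong walk (toℕ-fromℕ< (s≤s i≤end))))

    onWalk-elim : ∀ x → onWalk x ≡ true → Σ ℕ λ i → i ≤ end × walk i ≡ x
    onWalk-elim x x∈ with anyᵇ-elim (λ (k : Fin (suc end)) → does (walk (toℕ k) ≟ x)) x∈
    ... | i , walk-i≡x = toℕ i , ≤-pred (toℕ<n i) , dec-true⁻¹ (walk (toℕ i) ≟ x) walk-i≡x

    forward-onWalk : ∀ i → i ≤ end → onWalk (step i (walk i)) ≡ true
    forward-onWalk i i≤end with m≤n⇒m<n∨m≡n i≤end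
    ... | inj₁ i<end = onWalk-intro (suc i) i<end
    ... | inj₂ refl = trans (cong onWalk end-stops) (onWalk-intro end ≤-refl)

    backward-onWalk : ∀ i → i ≤ end → onWalk (step (suc i) (walk i)) ≡ true
    backward-onWalk zero _ = trans (cong onWalk (trans (step-odd 1 refl w) w-N-exposed)) (onWalk-intro 0 z≤n)
    backward-onWalk (suc i) 1+i≤end =
      trans (cong onWalk (trans (step-parity (suc (suc i)) i (not-involutive (even i)) _) (walk-back i))) (onWalk-intro i (≤-trans (n≤1+n i) 1+i≤end))

    M-closed : ∀ x → onWalk x ≡ true → onWalk (mate M x) ≡ true
    M-closed x x∈ with onWalk-elim x x∈
    ... | i , i≤end , refl with even i in ei
    ...   | true = trans (cong onWalk (sym (step-even i ei _))) (forward-onWalk i i≤end)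
    ...   | false = trans (cong onWalk (sym (step-even (suc i) (cong not ei) _))) (backward-onWalk i i≤end)

    N-closed : ∀ x → onWalk x ≡ true → onWalk (mate N x) ≡ true
    N-closed x x∈ with onWalk-elim x x∈
    ... | i , i≤end , refl with even i in ei
    ...   | false = trans (cong onWalk (sym (step-odd i ei _))) (forward-onWalk i i≤end)
    ...   | true = trans (cong onWalk (sym (step-odd (suc i) (cong not ei) _))) (backward-onWalk i i≤end)

    -- An M-exposed vertex of the walk other than w stops it there, so it can only be the last vertex.
    M-exposed-onWalk⇒end : ∀ u → mate M u ≡ u → u ≢ w → onWalk u ≡ true → u ≡ walk end
    M-exposed-onWalk⇒end u u-exposed u≢w u∈ with onWalk-elim u u∈
    ... | zero , _ , walk0≡u = ⊥-elim (u≢w (sym walk0≡u))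
    ... | suc i , 1+i≤end , refl with even i ≟ᵇ true
    ...   | yes ei = ⊥-elim (<⇒≱ 1+i≤end (end-first i (begin
            walk (suc i)              ≡⟨ u-exposed ⟨
            mate M (walk (suc i))     ≡⟨ step-even i ei _ ⟨
            step i (walk (suc i))     ≡⟨ walk-back i ⟩
            walk i                    ∎)))
      where open ≡-Reasoning
    ...   | no i-odd = cong walk (sym (≤-antisym (end-first (suc i) (trans (step-even (suc i) (cong not (¬-not i-odd)) _) u-exposed)) 1+i≤end))

module GallaiLemma where

  open import Defs hiding (sym)
  open Counting
  open Matchings
  open AlternatingWalk
  open import Data.Bool using (true; false)
  open import Data.Empty using (⊥)
  open import Data.Fin using (Fin; _≟_)
  open import Data.Nat using (suc; _+_; _≤_; _<_; z≤n; s≤s)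
  open import Data.Nat.Properties using (≤-trans; ≤-reflexive; +-mono-≤; +-monoʳ-<; +-monoʳ-≤; +-cancelʳ-≤; +-cancelˡ-≤; +-comm; <⇒≱; ≮⇒≥)
  open import Data.Nat.Solver using (module +-*-Solver)
  open import Data.Product using (Σ; _×_; _,_; proj₁; proj₂)
  open import Relation.Binary.Construct.Closure.ReflexiveTransitive using (Star; ε; _◅_)
  open import Relation.Binary.PropositionalEquality
  open import Relation.Nullary using (yes; no; ¬_)
  open +-*-Solver

  edge⇒distinct : ∀ {n} (G : Graph n) {u w} → Edge G u w → u ≢ w
  edge⇒distinct G {u} uw refl with () ← trans (sym (irr G u)) uw

  module Gallai {n} (G : Graph n) {t} (T : IsTheta G t) where

    -- For triangle-free graphs θ = n - ν, so these are exactly the maximum matchings.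
    IsMaximum : Matching G → Set
    IsMaximum M = n + #exposed M ≤ t + t

    2θ≤n+#exposed : (M : Matching G) → t + t ≤ n + #exposed M
    2θ≤n+#exposed M = ≤-trans (+-mono-≤ θ≤ θ≤) (MatchingPartition.2#leaders≤n+#exposed M)
      where
      θ≤ : t ≤ count (MatchingPartition.leader M)
      θ≤ = proj₂ T _ (MatchingPartition.partition M)

    exposed-nonadjacent : (M : Matching G) → IsMaximum M → ∀ {u w} → u ≢ w → mate M u ≡ u → mate M w ≡ w → ¬ Edge G u w
    exposed-nonadjacent M maximum u≢w u-exposed w-exposed uw =
      <⇒≱ (+-monoʳ-< n fewer) (≤-trans maximum (2θ≤n+#exposed augmented))
      where
      open Augment M u≢w u-exposed w-exposed uw
      fewer : #exposed augmented < #exposed M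
      fewer = ≤-trans (≤-reflexive (+-comm 1 (#exposed augmented))) (≤-trans (+-monoʳ-≤ (#exposed augmented) (s≤s z≤n)) #exposed-augmented)

    exchange-maximum : (M N : Matching G) → IsMaximum M → IsMaximum N → ∀ P M-closed N-closed → IsMaximum (Exchange.M′ M N P M-closed N-closed)
    exchange-maximum M N M-maximum N-maximum P M-closed N-closed =
      +-cancelʳ-≤ (n + #exposed N′) (n + #exposed M′) (t + t)
        (≤-trans (≤-reflexive sums) (≤-trans (+-mono-≤ M-maximum N-maximum) (+-monoʳ-≤ (t + t) (2θ≤n+#exposed N′))))
      where
      open Exchange M N P M-closed N-closed
      sums : n + #exposed M′ + (n + #exposed N′) ≡ n + #exposed M + (n + #exposed N)
      sums = trans (regroup (#exposed M′) (#exposed N′)) (trans (cong (n + n +_) #exposed-exchange) (sym (regroup (#exposed M) (#exposed N))))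
        where
        regroup : ∀ a b → n + a + (n + b) ≡ n + n + (a + b)
        regroup = solve 3 (λ n a b → n :+ a :+ (n :+ b) := n :+ n :+ (a :+ b)) refl n

    -- Gallai's lemma: if every vertex is missed by some maximum matching, the exposed vertices of a maximum matching
    -- lie in different components.
    module _ (exposable : ∀ w → Σ (Matching G) λ N → IsMaximum N × mate N w ≡ w) where

      NeverBothExposed : Fin n → Fin n → Set
      NeverBothExposed u v = ∀ M → IsMaximum M → u ≢ v → mate M u ≡ u → mate M v ≡ v → ⊥

      -- If w is matched, exchanging M with a maximum matching exposing w along their alternating walk from w
      -- exposes w while keeping u or v exposed, unless both lie on the walk and are therefore its common end.
      neverBothExposed-step : ∀ {u w v} → Edge G u w → NeverBothExposed w v → NeverBothExposed u v
      neverBothExposed-step {u} {w} {v} uw w-v M M-maximum u≢v u-exposed v-exposed with w ≟ v | mate M w ≟ w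
      ... | yes refl | _ = exposed-nonadjacent M M-maximum u≢v u-exposed v-exposed uw
      ... | no w≢v | yes w-exposed = exposed-nonadjacent M M-maximum (edge⇒distinct G uw) u-exposed w-exposed uw
      ... | no w≢v | no _ with exposable w
      ...   | N , N-maximum , w-N-exposed = by-position (onWalk u) refl (onWalk v) refl
        where
        open Walk M N w w-N-exposed
        open Exchange M N onWalk M-closed N-closed
        M′-maximum : IsMaximum M′
        M′-maximum = exchange-maximum M N M-maximum N-maximum onWalk M-closed N-closed
        w-M′-exposed : mate M′ w ≡ w
        w-M′-exposed = trans (M′-inside w (onWalk-intro 0 z≤n)) w-N-exposed
        by-position : ∀ a → onWalk u ≡ a → ∀ b → onWalk v ≡ b → ⊥
        by-position false u∉ _ _ = exposed-nonadjacent M′ M′-maximum (edge⇒distinct G uw)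
          (trans (M′-outside u u∉) u-exposed) w-M′-exposed uw
        by-position _ _ false v∉ = w-v M′ M′-maximum w≢v w-M′-exposed (trans (M′-outside v v∉) v-exposed)
        by-position true u∈ true v∈ = u≢v (trans (M-exposed-onWalk⇒end u u-exposed (edge⇒distinct G uw) u∈)
          (sym (M-exposed-onWalk⇒end v v-exposed (λ v≡w → w≢v (sym v≡w)) v∈)))

      neverBothExposed : ∀ {u v} → Star (Edge G) u v → NeverBothExposed u v
      neverBothExposed ε M _ u≢u _ _ = u≢u refl
      neverBothExposed (uw ◅ walk) = neverBothExposed-step uw (neverBothExposed walk)

      connected⇒2θ≤1+n : Connected G → TriangleFree G → t + t ≤ suc n
      connected⇒2θ≤1+n connected triangle-free = ≮⇒≥ two-exposed-impossible
        where
        open PartitionMatching G triangle-free (proj₁ T) renaming (matching to M₀)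
        two-exposed-impossible : ¬ (suc n < t + t)
        two-exposed-impossible 1+n<2θ with 1<count⇒two-distinct (exposed M₀)
          (+-cancelˡ-≤ n 2 (#exposed M₀) (≤-trans (≤-reflexive (+-comm n 2)) (≤-trans 1+n<2θ (2θ≤n+#exposed M₀))))
        ... | u , v , u≢v , u-exposed , v-exposed = neverBothExposed (connected u v) M₀ n+#exposed≤2t u≢v
          (dec-true⁻¹ (mate M₀ u ≟ u) u-exposed) (dec-true⁻¹ (mate M₀ v ≟ v) v-exposed)

module CriticalGraphs where

  open import Defs hiding (sym)
  open Arithmetic
  open Existence using (hasGap)
  open Matchings
  open Deletion
  open GallaiLemma
  open import Data.Fin using (punchIn)
  open import Data.Fin.Properties using (punchIn-injective)
  open import Data.Integer using (+_; _-_)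
  import Data.Integer as ℤ
  open import Data.Nat using (ℕ; suc; _+_; _≤_; _<_; ⌈_/2⌉)
  open import Data.Nat.Properties using (≤-trans; ≤-antisym; m≤m+n; n<1+n; +-mono-≤; +-monoʳ-≤; +-monoˡ-≤; +-cancelʳ-<)
  open import Data.Product using (Σ; _×_; _,_; proj₁)
  open import Relation.Binary.PropositionalEquality

  ⌈n/2⌉≤θ : ∀ {n} (G : Graph n) → TriangleFree G → ∀ {t} → IsTheta G t → ⌈ n /2⌉ ≤ t
  ⌈n/2⌉≤θ {n} G triangle-free {t} (P , _) =
    n≤t+t⇒⌈n/2⌉≤t n t (≤-trans (m≤m+n n _) (PartitionMatching.n+#exposed≤2t G triangle-free P))

  -- In a gap-critical graph, deleting w lowers θ (α cannot grow), so an optimal clique partition of G - w plus the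
  -- singleton {w} is an optimal clique partition of G, and its matching is maximum and exposes w.
  critical⇒exposable : ∀ {n} (G : Graph n) → TriangleFree G → GapCritical G → ∀ {a t} → IsAlpha G a → (T : IsTheta G t) →
    ∀ w → Σ (Matching G) λ N → Gallai.IsMaximum G T N × mate N w ≡ w
  critical⇒exposable {suc n} G triangle-free critical {a} {t} A T w with hasGap (VertexDeletion.G-w G w)
  ... | _ , a′ , t′ , A′ , T′ , refl = matching , maximum , alone⇒unmatched w (addSingleton-alone P′)
    where
    open VertexDeletion G w
    P′ : CliquePartition G-w t′
    P′ = proj₁ T′
    open PartitionMatching G triangle-free (addSingleton P′)
    θ-drops : t′ < t
    θ-drops = +-cancelʳ-< a t′ t (≤-trans (diff<diff⇒ {t′} {a′} {t} {a}
      (critical n (punchIn w) (λ {x} {y} → punchIn-injective w x y) (n<1+n n) _ _ (a′ , t′ , A′ , T′ , refl) (a , t , A , T , refl)))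
      (+-monoʳ-≤ t (α-deletion≤α A A′)))
    maximum : suc n + #exposed matching ≤ t + t
    maximum = ≤-trans n+#exposed≤2t (+-mono-≤ θ-drops θ-drops)

  connected-critical⇒θ≡⌈n/2⌉ : ∀ {n} (G : Graph n) → Connected G → TriangleFree G → GapCritical G →
    ∀ {a t} → IsAlpha G a → IsTheta G t → t ≡ ⌈ n /2⌉
  connected-critical⇒θ≡⌈n/2⌉ {n} G connected triangle-free critical {t = t} A T = ≤-antisym
    (t+t≤1+n⇒t≤⌈n/2⌉ n t (Gallai.connected⇒2θ≤1+n G T (critical⇒exposable G triangle-free critical A T) connected triangle-free))
    (⌈n/2⌉≤θ G triangle-free T)

  gap≥⌈n/2⌉-α : (n : ℕ) (G : Graph n) → TriangleFree G →
    ∀ a t → IsAlpha G a → IsTheta G t → (+ ⌈ n /2⌉ - + a) ℤ.≤ (+ t - + a)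
  gap≥⌈n/2⌉-α n G triangle-free a t _ T = diff≤diff⇐ {⌈ n /2⌉} {a} {t} {a} (+-monoˡ-≤ a (⌈n/2⌉≤θ G triangle-free T))

  critical-gap≡⌈n/2⌉-α : (n : ℕ) (G : Graph n) → Connected G → TriangleFree G → GapCritical G →
    ∀ a t → IsAlpha G a → IsTheta G t → (+ t - + a) ≡ (+ ⌈ n /2⌉ - + a)
  critical-gap≡⌈n/2⌉-α n G connected triangle-free critical a t A T =
    cong (λ θ → + θ - + a) (connected-critical⇒θ≡⌈n/2⌉ G connected triangle-free critical A T)

module Additivity where

  open import Defs hiding (sym)
  open Counting
  open VertexSets
  open import Data.Bool using (Bool; true; false; _∧_; _∨_)
  import Data.Bool.Properties as Bool
  open import Data.Empty using (⊥; ⊥-elim)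
  open import Data.Fin using (Fin; zero; suc; _≟_; splitAt; _↑ˡ_; _↑ʳ_)
  open import Data.Fin.Properties using (suc-injective; ↑ˡ-injective; ↑ʳ-injective; splitAt-↑ˡ; splitAt-↑ʳ)
  open import Data.Integer using (ℤ; +_; _-_)
  import Data.Integer as ℤ
  open import Data.Integer.Properties using (pos-+)
  open import Data.Integer.Solver using (module +-*-Solver)
  open import Data.Nat using (ℕ; _+_; _≤_; z≤n)
  import Data.Nat as ℕ
  open import Data.Nat.Properties using (≤-refl; ≤-trans; +-mono-≤)
  open import Data.Product using (Σ; _×_; _,_)
  open import Data.Sum using (_⊎_; inj₁; inj₂)
  open import Relation.Binary.PropositionalEquality
  open import Relation.Nullary using (does)
  open import Relation.Nullary.Decidable using (dec-true)

  _∪ᵥ_ : ∀ {n} → VSet n → VSet n → VSet n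
  (X ∪ᵥ Y) x = X x ∨ Y x

  private
    ∨-introˡ : ∀ {a b} → a ≡ true → a ∨ b ≡ true
    ∨-introˡ refl = refl

    ∨-introʳ : ∀ {a b} → b ≡ true → a ∨ b ≡ true
    ∨-introʳ {a} refl = Bool.∨-zeroʳ a

    ∨-elim : ∀ {a b} → a ∨ b ≡ true → a ≡ false → b ≡ true
    ∨-elim a∨b refl = a∨b

    ∧-elimˡ : ∀ {a b} → a ∧ b ≡ true → a ≡ true
    ∧-elimˡ {true} _ = refl

    ∧-elimʳ : ∀ {a b} → a ∧ b ≡ true → b ≡ true
    ∧-elimʳ {true} b = b

    false≢true : false ≢ true
    false≢true ()

  isAlphaOn-cong : ∀ {n} {G : Graph n} {X Y : VSet n} {a} → (∀ x → X x ≡ Y x) → IsAlphaOn G X a → IsAlphaOn G Y a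
  isAlphaOn-cong X≗Y ((S , S⊆X , stable , size) , maximal) =
    (S , (λ i i∈ → trans (sym (X≗Y i)) (S⊆X i i∈)) , stable , size) , λ T T⊆Y → maximal T (λ i i∈ → trans (X≗Y i) (T⊆Y i i∈))

  partitionOn-cong : ∀ {n} {G : Graph n} {X Y : VSet n} {t} → (∀ x → X x ≡ Y x) → CliquePartitionOn G X t → CliquePartitionOn G Y t
  partitionOn-cong X≗Y (c , clique) = (λ x y∈ → c x (trans (X≗Y x) y∈)) , λ i j _ _ → clique i j _ _

  hasGapOn-cong : ∀ {n} {G : Graph n} {X Y : VSet n} {g} → (∀ x → X x ≡ Y x) → HasGapOn G X g → HasGapOn G Y g
  hasGapOn-cong {G = G} {X} {Y} X≗Y (a , t , A , (P , minimal) , g≡) =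
    a , t , isAlphaOn-cong {G = G} X≗Y A ,
    (partitionOn-cong {G = G} X≗Y P , λ k Q → minimal k (partitionOn-cong {G = G} {Y} {X} (λ x → sym (X≗Y x)) Q)) , g≡

  hasGapOn-∅ : ∀ {n} (G : Graph n) → HasGapOn G (λ _ → false) (+ 0)
  hasGapOn-∅ {n} G = 0 , 0 ,
    (((λ _ → false) , (λ _ ()) , (λ _ _ ()) , count-const-false {n}) ,
     (λ S S⊆∅ _ → subst (count S ≤_) (count-const-false {n}) (count-mono S⊆∅))) ,
    (((λ _ ()) , λ _ _ ()) , (λ _ _ → z≤n)) , refl

  module UsedClasses {n k} (X : VSet n) (c : ∀ x → X x ≡ true → Fin k) where

    hits : Fin k → (x : Fin n) → (b : Bool) → X x ≡ b → Bool
    hits j x true x∈ = does (c x x∈ ≟ j)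
    hits j x false _ = false

    used : Fin k → Bool
    used j = anyᵇ (λ x → hits j x (X x) refl)

    used-intro : ∀ x x∈ → used (c x x∈) ≡ true
    used-intro x x∈ = anyᵇ-intro _ x (hits-own (X x) refl)
      where
      hits-own : ∀ b (x∈′ : X x ≡ b) → hits (c x x∈) x b x∈′ ≡ true
      hits-own true x∈′ rewrite ≡-irrelevantᵇ x∈′ x∈ = dec-true (c x x∈ ≟ c x x∈) refl
      hits-own false x∉ = ⊥-elim (false≢true (trans (sym x∉) x∈))

    used-elim : ∀ j → used j ≡ true → Σ (Fin n) λ x → Σ (X x ≡ true) λ x∈ → c x x∈ ≡ j
    used-elim j j-used with anyᵇ-elim _ j-used
    ... | x , x-hits = hit (X x) refl x-hits
      where
      hit : ∀ b (x∈ : X x ≡ b) → hits j x b x∈ ≡ true → Σ (Fin n) λ x → Σ (X x ≡ true) λ x∈ → c x x∈ ≡ j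
      hit true x∈ x-hits = x , x∈ , dec-true⁻¹ (c x x∈ ≟ j) x-hits

    compact : ∀ {G : Graph n} → (∀ i j xi xj → c i xi ≡ c j xj → i ≢ j → Edge G i j) → CliquePartitionOn G X (count used)
    compact clique = (λ x x∈ → rank used (c x x∈) (used-intro x x∈)) , λ i j xi xj e → clique i j xi xj (rank-injective used _ _ e)

  module Additive {n} (G : Graph n) (X Y : VSet n)
    (disjoint : ∀ x → X x ≡ true → Y x ≡ true → ⊥)
    (no-edges : ∀ x y → X x ≡ true → Y y ≡ true → adj G x y ≡ false) where

    no-edges′ : ∀ x y → Y x ≡ true → X y ≡ true → adj G x y ≡ false
    no-edges′ x y y∈ x∈ = trans (Graph.sym G x y) (no-edges y x x∈ y∈)

    isAlphaOn-∪ : ∀ {a b} → IsAlphaOn G X a → IsAlphaOn G Y b → IsAlphaOn G (X ∪ᵥ Y) (a + b)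
    isAlphaOn-∪ {a} {b} ((SX , SX⊆X , stableX , refl) , maximalX) ((SY , SY⊆Y , stableY , refl) , maximalY) =
      (SX ∪ᵥ SY , S⊆X∪Y , stable , count-∨ SX SY SX∩SY≡∅) , maximal
      where
      side : ∀ x → (SX ∪ᵥ SY) x ≡ true → (SX x ≡ true) ⊎ (SY x ≡ true)
      side x x∈ with SX x
      ... | true = inj₁ refl
      ... | false = inj₂ x∈
      S⊆X∪Y : (SX ∪ᵥ SY) ⊆ᵥ (X ∪ᵥ Y)
      S⊆X∪Y x x∈ with side x x∈
      ... | inj₁ x∈SX = ∨-introˡ (SX⊆X x x∈SX)
      ... | inj₂ x∈SY = ∨-introʳ (SY⊆Y x x∈SY)
      stable : Stableᵥ G (SX ∪ᵥ SY)
      stable i j i∈ j∈ with side i i∈ | side j j∈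
      ... | inj₁ i∈SX | inj₁ j∈SX = stableX i j i∈SX j∈SX
      ... | inj₁ i∈SX | inj₂ j∈SY = no-edges i j (SX⊆X i i∈SX) (SY⊆Y j j∈SY)
      ... | inj₂ i∈SY | inj₁ j∈SX = no-edges′ i j (SY⊆Y i i∈SY) (SX⊆X j j∈SX)
      ... | inj₂ i∈SY | inj₂ j∈SY = stableY i j i∈SY j∈SY
      SX∩SY≡∅ : ∀ x → SX x ∧ SY x ≡ false
      SX∩SY≡∅ x with SX x in x∈SX | SY x in x∈SY
      ... | true | true = ⊥-elim (disjoint x (SX⊆X x x∈SX) (SY⊆Y x x∈SY))
      ... | true | false = refl
      ... | false | _ = refl
      maximal : ∀ S → S ⊆ᵥ (X ∪ᵥ Y) → Stableᵥ G S → count S ≤ a + b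
      maximal S S⊆X∪Y stableS = subst (_≤ a + b) (sym (count-split S X)) (+-mono-≤
        (maximalX _ (λ i i∈ → ∧-elimʳ {S i} i∈) (λ i j i∈ j∈ → stableS i j (∧-elimˡ i∈) (∧-elimˡ j∈)))
        (maximalY _ (λ i i∈ → ∨-elim (S⊆X∪Y i (∧-elimˡ i∈)) (Bool.not-injective (∧-elimʳ {S i} i∈)))
                    (λ i j i∈ j∈ → stableS i j (∧-elimˡ i∈) (∧-elimˡ j∈))))

    partitionOn-∪ : ∀ {tX tY} → CliquePartitionOn G X tX → CliquePartitionOn G Y tY → CliquePartitionOn G (X ∪ᵥ Y) (tX + tY)
    partitionOn-∪ {tX} {tY} (cX , cliqueX) (cY , cliqueY) = (λ x x∈ → c x x∈ (X x) refl) , λ i j i∈ j∈ → clique i j i∈ j∈ (X i) refl (X j) refl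
      where
      c : (x : Fin n) → (X ∪ᵥ Y) x ≡ true → (b : Bool) → X x ≡ b → Fin (tX + tY)
      c x _ true x∈X = cX x x∈X ↑ˡ tY
      c x x∈ false x∉X = tX ↑ʳ cY x (∨-elim x∈ x∉X)
      clique : ∀ i j i∈ j∈ bi ei bj ej → c i i∈ bi ei ≡ c j j∈ bj ej → i ≢ j → Edge G i j
      clique i j _ _ true ei true ej e = cliqueX i j ei ej (↑ˡ-injective tY _ _ e)
      clique i j _ _ false _ false _ e = cliqueY i j _ _ (↑ʳ-injective tX _ _ e)
      clique i j _ _ true ei false ej e with () ← trans (sym (splitAt-↑ˡ tX _ tY)) (trans (cong (splitAt tX) e) (splitAt-↑ʳ tX tY _))
      clique i j _ _ false ei true ej e with () ← trans (sym (splitAt-↑ʳ tX tY _)) (trans (cong (splitAt tX) e) (splitAt-↑ˡ tX _ tY))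

    -- Since no class contains vertices of both X and Y, the classes used by X and those used by Y are disjoint.
    partitionOn-split : ∀ {k} → CliquePartitionOn G (X ∪ᵥ Y) k →
      Σ ℕ λ kX → Σ ℕ λ kY → CliquePartitionOn G X kX × CliquePartitionOn G Y kY × kX + kY ≤ k
    partitionOn-split {k} (c , clique) = count usedX , count usedY , UX.compact {G} (λ i j _ _ → clique i j _ _) , UY.compact {G} (λ i j _ _ → clique i j _ _) , bound
      where
      module UX = UsedClasses X (λ x x∈ → c x (∨-introˡ x∈))
      module UY = UsedClasses Y (λ x x∈ → c x (∨-introʳ {X x} x∈))
      usedX usedY : Fin k → Bool
      usedX = UX.used
      usedY = UY.used
      pointwise : ∀ j → bit (usedX j) + bit (usedY j) ≤ bit true
      pointwise j with usedX j in ux | usedY j in uy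
      ... | false | false = z≤n
      ... | false | true = ≤-refl
      ... | true | false = ≤-refl
      ... | true | true with UX.used-elim j ux | UY.used-elim j uy
      ...   | x , x∈ , cx≡j | y , y∈ , cy≡j = ⊥-elim (false≢true (trans (sym (no-edges x y x∈ y∈))
              (clique x y _ _ (trans cx≡j (sym cy≡j)) (λ x≡y → disjoint x x∈ (subst (λ z → Y z ≡ true) (sym x≡y) y∈)))))
      bound : count usedX + count usedY ≤ k
      bound = subst (count usedX + count usedY ≤_) count-const-true (count+count≤count usedX usedY (λ _ → true) pointwise)

    isThetaOn-∪ : ∀ {tX tY} → IsThetaOn G X tX → IsThetaOn G Y tY → IsThetaOn G (X ∪ᵥ Y) (tX + tY)
    isThetaOn-∪ (PX , minimalX) (PY , minimalY) = partitionOn-∪ PX PY , λ k Q →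
      let (kX , kY , QX , QY , kX+kY≤k) = partitionOn-split Q in ≤-trans (+-mono-≤ (minimalX kX QX) (minimalY kY QY)) kX+kY≤k

    hasGapOn-∪ : ∀ {gX gY} → HasGapOn G X gX → HasGapOn G Y gY → HasGapOn G (X ∪ᵥ Y) (gX ℤ.+ gY)
    hasGapOn-∪ (a , t , A , T , refl) (a′ , t′ , A′ , T′ , refl) =
      a + a′ , t + t′ , isAlphaOn-∪ A A′ , isThetaOn-∪ T T′ , diff+diff t a t′ a′
      where
      open +-*-Solver
      diff+diff : ∀ t a t′ a′ → (+ t - + a) ℤ.+ (+ t′ - + a′) ≡ + (t + t′) - + (a + a′)
      diff+diff t a t′ a′ = trans (solve 4 (λ x y z w → (x :- y) :+ (z :- w) := (x :+ z) :- (y :+ w)) refl (+ t) (+ a) (+ t′) (+ a′))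
        (sym (cong₂ _-_ (pos-+ t t′) (pos-+ a a′)))

  hasGapOn-⋃ : ∀ {n} (G : Graph n) k (F : Fin k → VSet n) (γ : Fin k → ℤ) → (∀ c → HasGapOn G (F c) (γ c)) →
    (∀ c d x y → c ≢ d → F c x ≡ true → F d y ≡ true → adj G x y ≡ false) →
    (∀ c d x → c ≢ d → F c x ≡ true → F d x ≡ true → ⊥) →
    HasGapOn G (λ x → anyᵇ (λ c → F c x)) (sumℤ γ)
  hasGapOn-⋃ G ℕ.zero F γ gaps _ _ = hasGapOn-∅ G
  hasGapOn-⋃ G (ℕ.suc k) F γ gaps no-edges disjoint =
    Additive.hasGapOn-∪ G (F zero) (λ x → anyᵇ (λ c → F (suc c) x)) disjoint′ no-edges′ (gaps zero)
      (hasGapOn-⋃ G k (λ c → F (suc c)) (λ c → γ (suc c)) (λ c → gaps (suc c))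
        (λ c d x y c≢d → no-edges (suc c) (suc d) x y (λ e → c≢d (suc-injective e)))
        (λ c d x c≢d → disjoint (suc c) (suc d) x (λ e → c≢d (suc-injective e))))
    where
    disjoint′ : ∀ x → F zero x ≡ true → anyᵇ (λ c → F (suc c) x) ≡ true → ⊥
    disjoint′ x x∈ x∈rest with anyᵇ-elim (λ c → F (suc c) x) x∈rest
    ... | c , x∈c = disjoint zero (suc c) x (λ ()) x∈ x∈c
    no-edges′ : ∀ x y → F zero x ≡ true → anyᵇ (λ c → F (suc c) y) ≡ true → adj G x y ≡ false
    no-edges′ x y x∈ y∈rest with anyᵇ-elim (λ c → F (suc c) y) y∈rest
    ... | c , y∈c = no-edges zero (suc c) x y (λ ()) x∈ y∈c

module DisjointUnion where

  open import Defs hiding (sym)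
  open VertexSets
  open Additivity
  open import Data.Bool using (Bool; true; false; not)
  open import Data.Bool.Properties using (∨-inverseʳ)
  open import Data.Empty using (⊥)
  open import Data.Fin using (Fin; splitAt; join; _↑ˡ_; _↑ʳ_)
  open import Data.Fin.Properties using (↑ˡ-injective; ↑ʳ-injective; splitAt-↑ˡ; splitAt-↑ʳ; join-splitAt)
  import Data.Integer as ℤ
  open import Data.Nat using (ℕ; _+_)
  open import Data.Product using (Σ; _,_)
  open import Data.Sum using (_⊎_; inj₁; inj₂)
  open import Relation.Binary.PropositionalEquality

  hasGap-cong : ∀ {n} {H H′ : Graph n} → (∀ i j → adj H i j ≡ adj H′ i j) → ∀ {g} → HasGap H g → HasGap H′ g
  hasGap-cong {H = H} {H′} H≗H′ (a , t , ((S , stable , size) , maximal) , ((c , clique) , minimal) , g≡) =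
    a , t , ((S , (λ i j i∈ j∈ → trans (sym (H≗H′ i j)) (stable i j i∈ j∈)) , size) ,
             (λ S′ stable′ → maximal S′ (λ i j i∈ j∈ → trans (H≗H′ i j) (stable′ i j i∈ j∈)))) ,
    ((c , λ i j e i≢j → trans (sym (H≗H′ i j)) (clique i j e i≢j)) ,
     (λ k (c′ , clique′) → minimal k (c′ , λ i j e i≢j → trans (H≗H′ i j) (clique′ i j e i≢j)))) , g≡

  module _ {n₁ n₂ : ℕ} (G₁ : Graph n₁) (G₂ : Graph n₂) where

    adj⊎ : Fin n₁ ⊎ Fin n₂ → Fin n₁ ⊎ Fin n₂ → Bool
    adj⊎ (inj₁ a) (inj₁ b) = adj G₁ a b
    adj⊎ (inj₂ a) (inj₂ b) = adj G₂ a b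
    adj⊎ (inj₁ _) (inj₂ _) = false
    adj⊎ (inj₂ _) (inj₁ _) = false

    adj⊎-sym : ∀ x y → adj⊎ x y ≡ adj⊎ y x
    adj⊎-sym (inj₁ a) (inj₁ b) = Graph.sym G₁ a b
    adj⊎-sym (inj₂ a) (inj₂ b) = Graph.sym G₂ a b
    adj⊎-sym (inj₁ _) (inj₂ _) = refl
    adj⊎-sym (inj₂ _) (inj₁ _) = refl

    adj⊎-irr : ∀ x → adj⊎ x x ≡ false
    adj⊎-irr (inj₁ a) = irr G₁ a
    adj⊎-irr (inj₂ a) = irr G₂ a

    _⊕_ : Graph (n₁ + n₂)
    _⊕_ = record
      { adj = λ i j → adj⊎ (splitAt n₁ i) (splitAt n₁ j)
      ; sym = λ i j → adj⊎-sym (splitAt n₁ i) (splitAt n₁ j)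
      ; irr = λ i → adj⊎-irr (splitAt n₁ i) }

    ⊕-triangleFree : TriangleFree G₁ → TriangleFree G₂ → TriangleFree _⊕_
    ⊕-triangleFree tf₁ tf₂ i j k = triangle (splitAt n₁ i) (splitAt n₁ j) (splitAt n₁ k)
      where
      triangle : ∀ x y z → adj⊎ x y ≡ true → adj⊎ y z ≡ true → adj⊎ x z ≡ true → ⊥
      triangle (inj₁ a) (inj₁ b) (inj₁ c) = tf₁ a b c
      triangle (inj₂ a) (inj₂ b) (inj₂ c) = tf₂ a b c
      triangle (inj₁ _) (inj₁ _) (inj₂ _) _ ()
      triangle (inj₁ _) (inj₂ _) _ ()
      triangle (inj₂ _) (inj₁ _) _ ()
      triangle (inj₂ _) (inj₂ _) (inj₁ _) _ ()

    isLeft : Fin n₁ ⊎ Fin n₂ → Bool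
    isLeft (inj₁ _) = true
    isLeft (inj₂ _) = false

    left right : VSet (n₁ + n₂)
    left i = isLeft (splitAt n₁ i)
    right i = not (left i)

    ↑ˡ-enumerates : Enumerates (_↑ˡ n₂) left
    ↑ˡ-enumerates = record
      { injective = ↑ˡ-injective n₂
      ; into = λ x → cong isLeft (splitAt-↑ˡ n₁ x n₂)
      ; onto = λ y y∈ → preimage y (splitAt n₁ y) refl y∈ }
      where
      preimage : ∀ y s → splitAt n₁ y ≡ s → isLeft s ≡ true → Σ (Fin n₁) λ x → x ↑ˡ n₂ ≡ y
      preimage y (inj₁ a) split≡ _ = a , trans (cong (join n₁ n₂) (sym split≡)) (join-splitAt n₁ n₂ y)

    ↑ʳ-enumerates : Enumerates (n₁ ↑ʳ_) right
    ↑ʳ-enumerates = record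
      { injective = ↑ʳ-injective n₁
      ; into = λ x → cong (λ s → not (isLeft s)) (splitAt-↑ʳ n₁ n₂ x)
      ; onto = λ y y∈ → preimage y (splitAt n₁ y) refl y∈ }
      where
      preimage : ∀ y s → splitAt n₁ y ≡ s → not (isLeft s) ≡ true → Σ (Fin n₂) λ x → n₁ ↑ʳ x ≡ y
      preimage y (inj₂ a) split≡ _ = a , trans (cong (join n₁ n₂) (sym split≡)) (join-splitAt n₁ n₂ y)

    ⊕-hasGap : ∀ {g₁ g₂} → HasGap G₁ g₁ → HasGap G₂ g₂ → HasGap _⊕_ (g₁ ℤ.+ g₂)
    ⊕-hasGap {g₁} {g₂} gap₁ gap₂ = hasGapOn-all⇒hasGap _⊕_ (hasGapOn-cong {G = _⊕_} {X = left ∪ᵥ right} (λ x → ∨-inverseʳ (left x))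
      (Additive.hasGapOn-∪ _⊕_ left right disjoint no-edges gapˡ gapʳ))
      where
      adjˡ : ∀ i j → adj G₁ i j ≡ adj (induce _⊕_ (_↑ˡ n₂)) i j
      adjˡ i j rewrite splitAt-↑ˡ n₁ i n₂ | splitAt-↑ˡ n₁ j n₂ = refl
      adjʳ : ∀ i j → adj G₂ i j ≡ adj (induce _⊕_ (n₁ ↑ʳ_)) i j
      adjʳ i j rewrite splitAt-↑ʳ n₁ n₂ i | splitAt-↑ʳ n₁ n₂ j = refl
      gapˡ : HasGapOn _⊕_ left g₁
      gapˡ = Induced.hasGap⇒hasGapOn _⊕_ ↑ˡ-enumerates (hasGap-cong {H = G₁} {induce _⊕_ (_↑ˡ n₂)} adjˡ gap₁)
      gapʳ : HasGapOn _⊕_ right g₂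
      gapʳ = Induced.hasGap⇒hasGapOn _⊕_ ↑ʳ-enumerates (hasGap-cong {H = G₂} {induce _⊕_ (n₁ ↑ʳ_)} adjʳ gap₂)
      disjoint : ∀ x → left x ≡ true → right x ≡ true → ⊥
      disjoint x x∈ x∈′ rewrite x∈ with () ← x∈′
      no-edges⊎ : ∀ s s′ → isLeft s ≡ true → not (isLeft s′) ≡ true → adj⊎ s s′ ≡ false
      no-edges⊎ (inj₁ _) (inj₂ _) _ _ = refl
      no-edges : ∀ x y → left x ≡ true → right y ≡ true → adj _⊕_ x y ≡ false
      no-edges x y = no-edges⊎ (splitAt n₁ x) (splitAt n₁ y)

module GapDescent where

  open import Defs hiding (sym)
  open Arithmetic
  open Counting
  open VertexSets
  open Existence using (hasAlpha; hasTheta)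
  open Deletion
  open VertexDeletion using (G-w; gap>⇒deletion-gap≥)
  open import Data.Bool using (true)
  open import Data.Empty using (⊥-elim)
  open import Data.Fin using (zero; _≟_; punchIn)
  open import Data.Integer using (+_; _-_)
  import Data.Integer as ℤ
  open import Data.Nat using (ℕ; zero; suc; _+_; _≤_; _<_; s≤s)
  import Data.Nat as ℕ
  open import Data.Nat.Properties using (≤-refl; ≤-reflexive; ≤-trans; <⇒≤; <⇒≱; ≤∧≢⇒<; n≤0⇒n≡0; +-identityʳ)
  open import Data.Product using (Σ; Σ-syntax; _×_; _,_)
  open import Data.Vec using ([]; lookup)
  open import Relation.Binary.PropositionalEquality
  open import Relation.Nullary using (yes; no)

  α≤θ : ∀ {n} {G : Graph n} {a t} → IsAlpha G a → IsTheta G t → a ≤ t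
  α≤θ {G = G} {t = t} ((S , stable , refl) , _) ((c , clique) , _) =
    subst₂ _≤_ (sym (∣S∣≡count S)) count-const-true (count-≤-map (lookup S) (λ _ → true) c (λ _ _ → refl) distinct-classes)
    where
    distinct-classes : ∀ x y → lookup S x ≡ true → lookup S y ≡ true → c x ≡ c y → x ≡ y
    distinct-classes x y x∈ y∈ e with x ≟ y
    ... | yes x≡y = x≡y
    ... | no x≢y with () ← trans (sym (stable x y (lookup⇒∈ x∈) (lookup⇒∈ y∈))) (clique x y e x≢y)

  empty-α≡0 : ∀ (H : Graph 0) {a} → IsAlpha H a → a ≡ 0
  empty-α≡0 H (([] , _ , size) , _) = sym size

  empty-θ≡0 : ∀ (H : Graph 0) {t} → IsTheta H t → t ≡ 0
  empty-θ≡0 H (_ , minimal) = n≤0⇒n≡0 (minimal 0 ((λ ()) , λ ()))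

  -- Deleting a vertex lowers θ by at most one and does not raise α, so the gap drops by at most one per deletion
  -- and ends at 0 on the empty graph: every gap between 0 and gap(H) occurs on a triangle-free induced subgraph.
  module Descent {a₀ t₀ : ℕ} (a₀≤t₀ : a₀ ≤ t₀) where

    SmallerWithGap : ℕ → Set
    SmallerWithGap m = Σ (Graph m) λ H′ → TriangleFree H′ × HasGap H′ (+ t₀ - + a₀)

    mutual
      descend : ∀ m (H : Graph m) → TriangleFree H → ∀ {a t} → IsAlpha H a → IsTheta H t → t₀ + a ≤ t + a₀ →
        Σ[ m′ ∈ ℕ ] m′ ≤ m × SmallerWithGap m′
      descend m H triangle-free {a} {t} A T below with t₀ + a ℕ.≟ t + a₀
      ... | yes equal = m , ≤-refl , H , triangle-free , a , t , A , T , diff≡diff⇐ {t₀} {a₀} {t} {a} equal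
      ... | no unequal with descend-strict m H triangle-free A T (≤∧≢⇒< below unequal)
      ...   | m′ , m′<m , H′ = m′ , <⇒≤ m′<m , H′

      descend-strict : ∀ m (H : Graph m) → TriangleFree H → ∀ {a t} → IsAlpha H a → IsTheta H t → t₀ + a < t + a₀ →
        Σ[ m′ ∈ ℕ ] m′ < m × SmallerWithGap m′
      descend-strict zero H _ A T above rewrite empty-α≡0 H A | empty-θ≡0 H T =
        ⊥-elim (<⇒≱ above (≤-trans a₀≤t₀ (≤-reflexive (sym (+-identityʳ t₀)))))
      descend-strict (suc m) H triangle-free A T above with hasAlpha (G-w H zero) | hasTheta (G-w H zero)
      ... | a′ , A′ | t′ , T′ with descend m (G-w H zero) (induce-triangleFree H (punchIn zero) triangle-free) A′ T′
                                     (gap>⇒deletion-gap≥ H zero A T A′ T′ a₀ t₀ above)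
      ...   | m′ , m′≤m , H′ = m′ , s≤s m′≤m , H′

    descend-gap : ∀ m (H : Graph m) → TriangleFree H → ∀ {h} → HasGap H h → + t₀ - + a₀ ℤ.≤ h →
      Σ[ m′ ∈ ℕ ] m′ ≤ m × SmallerWithGap m′
    descend-gap m H triangle-free (a , t , A , T , refl) below = descend m H triangle-free A T (diff≤diff⇒ {t₀} {a₀} {t} {a} below)

    descend-gap-strict : ∀ m (H : Graph m) → TriangleFree H → ∀ {h} → HasGap H h → + t₀ - + a₀ ℤ.< h →
      Σ[ m′ ∈ ℕ ] m′ < m × SmallerWithGap m′
    descend-gap-strict m H triangle-free (a , t , A , T , refl) above = descend-strict m H triangle-free A T (diff<diff⇒ {t₀} {a₀} {t} {a} above)

module ExtremalGraphs where

  open import Defs hiding (sym)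
  open Arithmetic
  open Counting
  open VertexSets
  open Existence using (hasGapOn; hasTheta; hasGap-unique)
  open Additivity
  open DisjointUnion
  open GapDescent
  open CriticalGraphs
  open import Data.Bool using (true; false; not; _∨_)
  open import Data.Bool.Properties using (∨-inverseʳ)
  open import Data.Empty using (⊥; ⊥-elim)
  open import Data.Fin using (Fin; zero; suc; _≟_)
  open import Data.Integer using (ℤ; +_; _-_)
  import Data.Integer as ℤ
  import Data.Integer.Properties as ℤ
  open import Data.Nat using (ℕ; _+_; _≤_; _<_; ⌈_/2⌉)
  import Data.Nat as ℕ
  open import Data.Nat.Properties using (≤-refl; ≤-reflexive; ≤-trans; ≤-antisym; <⇒≱; ≤-<-trans; +-monoˡ-<; +-monoˡ-≤; +-cancelˡ-≤)
  open import Data.Product using (_,_; proj₁; proj₂)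
  open import Relation.Binary.Construct.Closure.ReflexiveTransitive using (Star; ε; _◅_)
  open import Relation.Binary.PropositionalEquality
  open import Relation.Nullary using (yes; no; does)
  open import Relation.Nullary.Decidable using (dec-true)

  sumℤ-cong : ∀ {k} {f h : Fin k → ℤ} → (∀ c → f c ≡ h c) → sumℤ f ≡ sumℤ h
  sumℤ-cong {ℕ.zero} f≗h = refl
  sumℤ-cong {ℕ.suc k} f≗h = cong₂ ℤ._+_ (f≗h zero) (sumℤ-cong (λ c → f≗h (suc c)))

  module SmallestOrder {g₀ s} (s₂ : IsS2 g₀ s) where

    s₂≤order : ∀ {m} (H : Graph m) → TriangleFree H → ∀ {h} → HasGap H h → g₀ ℤ.≤ h → s ≤ m
    s₂≤order {m} H triangle-free gap g₀≤h with proj₁ s₂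
    ... | H₀ , _ , a₀ , t₀ , A₀ , T₀ , refl with Descent.descend-gap (α≤θ {G = H₀} A₀ T₀) m H triangle-free gap g₀≤h
    ...   | m′ , m′≤m , H′ , tf′ , gap′ = ≤-trans (proj₂ s₂ m′ H′ tf′ gap′) m′≤m

    s₂<order : ∀ {m} (H : Graph m) → TriangleFree H → ∀ {h} → HasGap H h → g₀ ℤ.< h → s < m
    s₂<order {m} H triangle-free gap g₀<h with proj₁ s₂
    ... | H₀ , _ , a₀ , t₀ , A₀ , T₀ , refl with Descent.descend-gap-strict (α≤θ {G = H₀} A₀ T₀) m H triangle-free gap g₀<h
    ...   | m′ , m′<m , H′ , tf′ , gap′ = ≤-<-trans (proj₂ s₂ m′ H′ tf′ gap′) m′<m

  extremal⇒gap≡gap₂ : ∀ {n} (G : Graph n) → TriangleFree G → ∀ {g₀} → HasGap G g₀ → IsS2 g₀ n → ∀ {g} → IsGap2 n g → g₀ ≡ g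
  extremal⇒gap≡gap₂ G triangle-free gap₀ s₂ ((H , tfH , gapH) , maximal) =
    ℤ.≤-antisym (maximal G triangle-free _ gap₀) (ℤ.≮⇒≥ λ g₀<g → <⇒≱ (SmallestOrder.s₂<order s₂ H tfH gapH g₀<g) ≤-refl)

  gap≤gap₂ : ∀ {n g} → IsGap2 n g → ∀ {m} → m ≡ n → (H : Graph m) → TriangleFree H → ∀ {h} → HasGap H h → h ℤ.≤ g
  gap≤gap₂ (_ , maximal) refl H triangle-free gap = maximal H triangle-free _ gap

  module ExtremalComponents {n} (G : Graph n) (triangle-free : TriangleFree G) {g₀} (gap₀ : HasGap G g₀) (s₂ : IsS2 g₀ n)
    (k : ℕ) (comp : Fin n → Fin k) (labelling : IsComponentLabelling G k comp) where

    same-component : ∀ {x y} → Edge G x y → comp x ≡ comp y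
    same-component xy = proj₂ (proj₂ labelling _ _) (xy ◅ ε)

    F : Fin k → VSet n
    F c x = does (comp x ≟ c)

    F-elim : ∀ {c x} → F c x ≡ true → comp x ≡ c
    F-elim {c} {x} = dec-true⁻¹ (comp x ≟ c)

    F-intro : ∀ {c x} → comp x ≡ c → F c x ≡ true
    F-intro {c} {x} = dec-true (comp x ≟ c)

    rest : Fin k → VSet n
    rest c x = not (F c x)

    γ ρ : Fin k → ℤ
    γ c = proj₁ (hasGapOn G (F c))
    ρ c = proj₁ (hasGapOn G (rest c))

    γ-gap : ∀ c → HasGapOn G (F c) (γ c)
    γ-gap c = proj₂ (hasGapOn G (F c))

    ρ-gap : ∀ c → HasGapOn G (rest c) (ρ c)
    ρ-gap c = proj₂ (hasGapOn G (rest c))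

    g₀≡∑γ : g₀ ≡ sumℤ γ
    g₀≡∑γ = hasGap-unique {G = G} gap₀ (hasGapOn-all⇒hasGap G (hasGapOn-cong {G = G} covered
      (hasGapOn-⋃ G k F γ γ-gap no-edges disjoint)))
      where
      covered : ∀ x → anyᵇ (λ c → F c x) ≡ true
      covered x = anyᵇ-intro (λ c → F c x) (comp x) (F-intro refl)
      no-edges : ∀ c d x y → c ≢ d → F c x ≡ true → F d y ≡ true → adj G x y ≡ false
      no-edges c d x y c≢d x∈ y∈ with adj G x y in xy
      ... | false = refl
      ... | true = ⊥-elim (c≢d (trans (sym (F-elim x∈)) (trans (same-component xy) (F-elim y∈))))
      disjoint : ∀ c d x → c ≢ d → F c x ≡ true → F d x ≡ true → ⊥
      disjoint c d x c≢d x∈c x∈d = c≢d (trans (sym (F-elim x∈c)) (F-elim x∈d))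

    g₀≡γ+ρ : ∀ c → g₀ ≡ γ c ℤ.+ ρ c
    g₀≡γ+ρ c = hasGap-unique {G = G} gap₀ (hasGapOn-all⇒hasGap G (hasGapOn-cong {G = G} covered
      (Additive.hasGapOn-∪ G (F c) (rest c) disjoint no-edges (γ-gap c) (ρ-gap c))))
      where
      covered : ∀ x → (F c x ∨ not (F c x)) ≡ true
      covered x = ∨-inverseʳ (F c x)
      disjoint : ∀ x → F c x ≡ true → rest c x ≡ true → ⊥
      disjoint x x∈ x∉ rewrite x∈ with () ← x∉
      no-edges : ∀ x y → F c x ≡ true → rest c y ≡ true → adj G x y ≡ false
      no-edges x y x∈ y∉ with adj G x y in xy | F c y in y∈
      ... | false | _ = refl
      ... | true | true with () ← y∉
      ... | true | false with () ← trans (sym y∈) (F-intro (trans (sym (same-component xy)) (F-elim x∈)))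

    order : Fin k → ℕ
    order c = compOrder comp c

    order+rest≡n : ∀ c → order c + count (rest c) ≡ n
    order+rest≡n c = sym (trans (sym count-const-true) (count-split (λ _ → true) (F c)))

    component : (c : Fin k) → Graph (order c)
    component c = induce G (enum (F c))

    rest-graph : (c : Fin k) → Graph (count (rest c))
    rest-graph c = induce G (enum (rest c))

    component-triangleFree : ∀ c → TriangleFree (component c)
    component-triangleFree c = induce-triangleFree G (enum (F c)) triangle-free

    rest-triangleFree : ∀ c → TriangleFree (rest-graph c)
    rest-triangleFree c = induce-triangleFree G (enum (rest c)) triangle-free

    component-gap : ∀ c → HasGap (component c) (γ c)
    component-gap c = Induced.hasGapOn⇒hasGap G (enum-enumerates (F c)) (γ-gap c)

    rest-gap : ∀ c → HasGap (rest-graph c) (ρ c)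
    rest-gap c = Induced.hasGapOn⇒hasGap G (enum-enumerates (rest c)) (ρ-gap c)

    component-connected : ∀ c → Connected (component c)
    component-connected c i j = subst₂ (Star (Edge (component c))) (rank-enum (F c) i _) (rank-enum (F c) j _)
      (lift (proj₁ (proj₂ labelling _ _) (trans (F-elim (enum-true (F c) i)) (sym (F-elim (enum-true (F c) j)))))
            (enum-true (F c) i) (enum-true (F c) j))
      where
      lift : ∀ {x y} → Star (Edge G) x y → (x∈ : F c x ≡ true) → (y∈ : F c y ≡ true) →
        Star (Edge (component c)) (rank (F c) x x∈) (rank (F c) y y∈)
      lift ε x∈ y∈ rewrite ≡-irrelevantᵇ x∈ y∈ = ε
      lift {x} (_◅_ {j = z} xz walk) x∈ y∈ = edge ◅ lift walk z∈ y∈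
        where
        z∈ : F c z ≡ true
        z∈ = F-intro (trans (sym (same-component xz)) (F-elim x∈))
        edge : Edge (component c) (rank (F c) x x∈) (rank (F c) z z∈)
        edge = subst₂ (Edge G) (sym (enum-rank (F c) x x∈)) (sym (enum-rank (F c) z z∈)) xz

    -- A proper induced subgraph of a component whose gap does not drop, together with the rest of G, would be a
    -- triangle-free graph on fewer than n = s₂(g₀) vertices with gap at least g₀.
    component-critical : ∀ c → GapCritical (component c)
    component-critical c m f _ m<order h γ′ gap-h gap-γ′ with h ℤ.<? γ′
    ... | yes h<γ′ = h<γ′
    ... | no h≮γ′ = ⊥-elim (<⇒≱ fewer (SmallestOrder.s₂≤order s₂ K K-triangleFree (⊕-hasGap _ _ gap-h (rest-gap c)) g₀≤gap))
      where
      K : Graph (m + count (rest c))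
      K = induce (component c) f ⊕ rest-graph c
      fewer : m + count (rest c) < n
      fewer = subst (m + count (rest c) <_) (order+rest≡n c) (+-monoˡ-< (count (rest c)) m<order)
      K-triangleFree : TriangleFree K
      K-triangleFree = ⊕-triangleFree _ _ (induce-triangleFree (component c) f (component-triangleFree c)) (rest-triangleFree c)
      g₀≤gap : g₀ ℤ.≤ h ℤ.+ ρ c
      g₀≤gap = begin
        g₀           ≡⟨ g₀≡γ+ρ c ⟩
        γ c ℤ.+ ρ c  ≡⟨ cong (ℤ._+ ρ c) (hasGap-unique {G = component c} gap-γ′ (component-gap c)) ⟨
        γ′ ℤ.+ ρ c   ≤⟨ ℤ.+-monoˡ-≤ (ρ c) (ℤ.≮⇒≥ h≮γ′) ⟩
        h ℤ.+ ρ c    ∎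
        where open ℤ.≤-Reasoning

    module _ {g} (gap₂ : IsGap2 n g) (as : Fin k → ℕ) (α-order : ∀ c → IsAlphaN (order c) (as c)) where

      -- Replacing a component by a triangle-free graph H of the same order with α(H) = α(n_c) cannot increase
      -- the gap beyond gap₂(n) = g₀, and θ(H) ≥ ⌈n_c/2⌉ = θ(component).
      component-gap-value : ∀ c → γ c ≡ + ⌈ order c /2⌉ - + as c
      component-gap-value c with component-gap c | α-order c
      ... | a , t , A , T , γ≡ | (H , tfH , AH) , minimal = trans γ≡ (cong₂ (λ x y → + x - + y) θ≡ α≡)
        where
        θ≡ : t ≡ ⌈ order c /2⌉
        θ≡ = connected-critical⇒θ≡⌈n/2⌉ (component c) (component-connected c) (component-triangleFree c) (component-critical c) A T
        tH : ℕ
        tH = proj₁ (hasTheta H)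
        TH : IsTheta H tH
        TH = proj₂ (hasTheta H)
        replaced : (+ tH - + as c) ℤ.+ ρ c ℤ.≤ (+ t - + a) ℤ.+ ρ c
        replaced = subst ((+ tH - + as c) ℤ.+ ρ c ℤ.≤_) (trans (sym (extremal⇒gap≡gap₂ G triangle-free gap₀ s₂ gap₂)) (trans (g₀≡γ+ρ c) (cong (ℤ._+ ρ c) γ≡)))
          (gap≤gap₂ gap₂ (order+rest≡n c) (H ⊕ rest-graph c) (⊕-triangleFree _ _ tfH (rest-triangleFree c))
                    (⊕-hasGap _ _ (as c , tH , AH , TH , refl) (rest-gap c)))
        tH+a≤t+as : tH + a ≤ t + as c
        tH+a≤t+as = diff≤diff⇒ {tH} {as c} {t} {a} (+-cancelʳ-≤ᶻ (ρ c) replaced)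
        α≡ : a ≡ as c
        α≡ = ≤-antisym (+-cancelˡ-≤ tH a (as c) (≤-trans tH+a≤t+as (+-monoˡ-≤ (as c) (≤-trans (≤-reflexive θ≡) (⌈n/2⌉≤θ H tfH TH)))))
                       (minimal (component c) (component-triangleFree c) a A)

      gap₂≡∑ : g ≡ sumℤ (λ c → + ⌈ order c /2⌉ - + as c)
      gap₂≡∑ = trans (sym (extremal⇒gap≡gap₂ G triangle-free gap₀ s₂ gap₂)) (trans g₀≡∑γ (sumℤ-cong component-gap-value))

  gap₂≡∑component-gaps : (n : ℕ) (G : Graph n) → GapExtremalTF G →
    (k : ℕ) (comp : Fin n → Fin k) → IsComponentLabelling G k comp →
    ∀ g → IsGap2 n g → (as : Fin k → ℕ) → (∀ c → IsAlphaN (compOrder comp c) (as c)) →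
    g ≡ sumℤ (λ c → + ⌈ compOrder comp c /2⌉ - + as c)
  gap₂≡∑component-gaps n G (triangle-free , _ , gap₀ , s₂) k comp labelling g gap₂ =
    ExtremalComponents.gap₂≡∑ G triangle-free gap₀ s₂ k comp labelling gap₂

open import Defs
open CriticalGraphs using (gap≥⌈n/2⌉-α; critical-gap≡⌈n/2⌉-α)
open ExtremalGraphs using (gap₂≡∑component-gaps)
open import Data.Nat using (ℕ; ⌈_/2⌉)
open import Data.Integer using (+_; _-_; _≤_)
open import Data.Fin using (Fin)
open import Data.Product using (_×_; _,_)
open import Relation.Binary.PropositionalEquality using (_≡_)

proposition3p12 :
    ((n : ℕ) (G : Graph n) → TriangleFree G →
      ∀ a t → IsAlpha G a → IsTheta G t → (+ ⌈ n /2⌉ - + a) ≤ (+ t - + a))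
    ×
    ((n : ℕ) (G : Graph n) → Connected G → TriangleFree G → GapCritical G →
      ∀ a t → IsAlpha G a → IsTheta G t → (+ t - + a) ≡ (+ ⌈ n /2⌉ - + a))
    ×
    ((n : ℕ) (G : Graph n) → GapExtremalTF G →
      (k : ℕ) (comp : Fin n → Fin k) → IsComponentLabelling G k comp →
      ∀ g → IsGap2 n g →
      (as : Fin k → ℕ) → (∀ c → IsAlphaN (compOrder comp c) (as c)) →
      g ≡ sumℤ (λ c → + ⌈ compOrder comp c /2⌉ - + as c))
proposition3p12 = gap≥⌈n/2⌉-α , critical-gap≡⌈n/2⌉-α , gap₂≡∑component-gaps
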